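{- Let $\mathcal{M}=(E,\mathcal{C})$ be a loopless oriented matroid with ground set $E=\{e_1,\dots,e_m\}$ totally ordered by $e_1\prec\cdots\prec e_m$, $E_k=\{e_1,\dots,e_k\}$, and for $N\subseteq E_k$ write $N^c=E_k-N$. Let $\mathscr{N}_k$ ($0\le k\le m$) be the set of pairs $(N_k,A_k)$ with $N_k\subseteq E_k$, $A_k\subseteq E-E_k$, $N_k$ an NBC subset of $\underline{\mathcal{M}}$, and ${}_{ -A_k}(\mathcal{M}\backslash N_k^c/N_k)$ acyclic. For $1\le k\le m$ define $\psi_k$ on $\mathscr{N}_{k-1}$ by $$\psi_k(N_{k-1},A_{k-1})=\begin{cases}(N_{k-1}\cup\{e_k\},A_{k-1}) & \text{if } e_k\notin A_{k-1}\text{ and } {}_{ -\{e_k\}}\mathcal{M}_{k-1}\text{ is acyclic};\\ (N_{k-1},A_{k-1}) & \text{if } e_k\notin A_{k-1}\text{ and } {}_{ -\{e_k\}}\mathcal{M}_{k-1}\text{ is not acyclic};\\ (N_{k-1},A_{k-1}-\{e_k\}) & \text{if } e_k\in A_{k-1},\end{cases}$$ where $\mathcal{M}_{k-1}={}_{ -A_{k-1}}(\mathcal{M}\backslash N_{k-1}^c/N_{k-1})$. Then each $\psi_k$ is a bijection $\mathscr{N}_{k-1}\to\mathscr{N}_k$, and the composition $\psi=\psi_m\circ\cdots\circ\psi_1$ is a bijection from $\mathscr{N}_0=\{(\emptyset,A):A\in A(\mathcal{M})\}$ to $\mathscr{N}_m=\{(N,\emptyset):N\in\mathrm{NBC}(\underline{\mathcal{M}})\}$.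 Consequently, the map sending $A\in A(\mathcal{M})$ to the set $N$ with $\psi(\emptyset,A)=(N,\emptyset)$ is a bijection $A(\mathcal{M})\to\mathrm{NBC}(\underline{\mathcal{M}})$.
   Context: Signed circuits $X=(X^+,X^-)$, support $\underline{X}=X^+\cup X^-$; positive circuit: $X^-=\emptyset$; acyclic: no positive circuits. The underlying matroid $\underline{\mathcal{M}}$ has circuits $\{\underline{X}:X\in\mathcal{C}\}$. A broken circuit is a circuit of $\underline{\mathcal{M}}$ minus its $\prec$-maximal element; $\mathrm{NBC}(\underline{\mathcal{M}})$ is the set of subsets of $E$ containing no broken circuit. Reorientation ${}_{ -A}\mathcal{M}$ has signed circuits $((X^+-A)\cup(X^-\cap A),(X^--A)\cup(X^+\cap A))$; $A(\mathcal{M})$ is the set of $A\subseteq E$ with ${}_{ -A}\mathcal{M}$ acyclic. Deletion $\mathcal{M}\backslash S$: signed circuits $Y$ with $\underline{Y}\subseteq E-S$; contraction $\mathcal{M}/S$: support-minimal nonempty members of $\{(Y^+-S,Y^--S):Y\in\mathcal{C},\underline{Y}-S\neq\emptyset\}$. -}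

module Defs where

open import Data.Bool using (Bool; true; false; not; _∧_; _∨_; if_then_else_; T)
open import Data.Nat using (ℕ; suc; _<ᵇ_; _≤_)
open import Data.Fin using (Fin; toℕ)
open import Data.Fin.Subset using (Subset; ⊥; ⁅_⁆; _∈_; _⊆_; _∩_; _∪_; _─_)
open import Data.Vec using (Vec; []; _∷_; tabulate)
open import Data.List.Base as L using ()
open import Data.List.Base using (List; map; filterᵇ; allFin; foldl)
open import Data.List.Membership.Propositional using () renaming (_∈_ to _∈ˡ_)
open import Data.Product using (_×_; _,_; proj₁; proj₂; Σ; ∃)
open import Data.Sum using (_⊎_)
open import Relation.Nullary using (¬_)
open import Relation.Binary.PropositionalEquality using (_≡_; _≢_)

-- Ground set E = Fin m, totally ordered by e₁ ≺ ⋯ ≺ eₘ, where eᵢ is the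
-- element with index i-1 (the usual order on Fin m).
-- Subsets of E are Data.Fin.Subset (= Vec Bool m).

all : ∀ {A : Set} → (A → Bool) → L.List A → Bool
all p L.[] = true
all p (x L.∷ xs) = p x ∧ all p xs

isEmptyᵇ : ∀ {n} → Subset n → Bool
isEmptyᵇ []       = true
isEmptyᵇ (x ∷ xs) = not x ∧ isEmptyᵇ xs

_⊆ᵇ_ : ∀ {n} → Subset n → Subset n → Bool
[]       ⊆ᵇ []       = true
(x ∷ xs) ⊆ᵇ (y ∷ ys) = (not x ∨ y) ∧ (xs ⊆ᵇ ys)

_==ᵇ_ : ∀ {n} → Subset n → Subset n → Bool
p ==ᵇ q = (p ⊆ᵇ q) ∧ (q ⊆ᵇ p)

SignedSet : ℕ → Set
SignedSet m = Subset m × Subset m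

pos neg supp : ∀ {m} → SignedSet m → Subset m
pos  X = proj₁ X
neg  X = proj₂ X
supp X = pos X ∪ neg X

opp : ∀ {m} → SignedSet m → SignedSet m
opp (p , n) = (n , p)

-- Oriented matroids given by their (finite) set of signed circuits,
-- listed in a List (the set of circuits is the set of list members).

record OrientedMatroid (m : ℕ) : Set where
  field
    circuits : List (SignedSet m)
    signed   : ∀ X → X ∈ˡ circuits → pos X ∩ neg X ≡ ⊥
    C0 : ∀ X → X ∈ˡ circuits → supp X ≢ ⊥
    C1 : ∀ X → X ∈ˡ circuits → opp X ∈ˡ circuits
    C2 : ∀ X Y → X ∈ˡ circuits → Y ∈ˡ circuits → supp X ⊆ supp Y →
         (X ≡ Y) ⊎ (X ≡ opp Y)
    C3 : ∀ X Y e → X ∈ˡ circuits → Y ∈ˡ circuits → X ≢ opp Y →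
         e ∈ pos X → e ∈ neg Y →
         Σ (SignedSet m) λ Z → Z ∈ˡ circuits ×
           (pos Z ⊆ ((pos X ∪ pos Y) ─ ⁅ e ⁆)) ×
           (neg Z ⊆ ((neg X ∪ neg Y) ─ ⁅ e ⁆))

open OrientedMatroid public

Loopless : ∀ {m} → OrientedMatroid m → Set
Loopless {m} M = ∀ X (e : Fin m) → X ∈ˡ circuits M → supp X ≢ ⁅ e ⁆

-- Operations on families of signed circuits (all on ground set Fin m;
-- a minor on E - S is represented by its circuits, whose supports avoid S).

reorientSet : ∀ {m} → Subset m → SignedSet m → SignedSet m
reorientSet A (p , n) = ((p ─ A) ∪ (n ∩ A)) , ((n ─ A) ∪ (p ∩ A))

reorient : ∀ {m} → Subset m → List (SignedSet m) → List (SignedSet m)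
reorient A Cs = map (reorientSet A) Cs

delete : ∀ {m} → Subset m → List (SignedSet m) → List (SignedSet m)
delete S Cs = filterᵇ (λ Y → isEmptyᵇ (supp Y ∩ S)) Cs

contract : ∀ {m} → Subset m → List (SignedSet m) → List (SignedSet m)
contract S Cs = filterᵇ minimal D
  where
  D = map (λ Y → (pos Y ─ S) , (neg Y ─ S))
          (filterᵇ (λ Y → not (isEmptyᵇ (supp Y ─ S))) Cs)
  minimal : _ → Bool
  minimal Z = all (λ Z' → not (supp Z' ⊆ᵇ supp Z) ∨ (supp Z' ==ᵇ supp Z)) D

acyclic : ∀ {m} → List (SignedSet m) → Bool
acyclic Cs = all (λ X → not (isEmptyᵇ (neg X))) Cs

InA : ∀ {m} → OrientedMatroid m → Subset m → Set
InA M A = T (acyclic (reorient A (circuits M)))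

NBC : ∀ {m} → OrientedMatroid m → Subset m → Set
NBC {m} M N = ∀ X (e : Fin m) → X ∈ˡ circuits M → e ∈ supp X →
  (∀ f → f ∈ supp X → toℕ f ≤ toℕ e) → ¬ ((supp X ─ ⁅ e ⁆) ⊆ N)

Eₖ : ∀ {m} → ℕ → Subset m
Eₖ k = tabulate (λ i → toℕ i <ᵇ k)

minorCircuits : ∀ {m} → OrientedMatroid m → ℕ → Subset m → Subset m →
                List (SignedSet m)
minorCircuits M k N A = reorient A (contract N (delete (Eₖ k ─ N) (circuits M)))

Pair : ℕ → Set
Pair m = Subset m × Subset m

𝒩 : ∀ {m} → OrientedMatroid m → ℕ → Pair m → Set
𝒩 M k (N , A) =
  (N ⊆ Eₖ k) × (A ∩ Eₖ k ≡ ⊥) × NBC M N × T (acyclic (minorCircuits M k N A))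

-- ψ_k, where e = e_k has index k-1, so k-1 = toℕ e
_∈ᵇ_ : ∀ {m} → Fin m → Subset m → Bool
e ∈ᵇ S = not (isEmptyᵇ (⁅ e ⁆ ∩ S))

ψₖ : ∀ {m} → OrientedMatroid m → Fin m → Pair m → Pair m
ψₖ M e (N , A) =
  if e ∈ᵇ A then (N , (A ─ ⁅ e ⁆))
  else (if acyclic (reorient ⁅ e ⁆ (minorCircuits M (toℕ e) N A))
        then ((N ∪ ⁅ e ⁆) , A)
        else (N , A))

ψ : ∀ {m} → OrientedMatroid m → Pair m → Pair m
ψ {m} M p = foldl (λ q e → ψₖ M e q) p (allFin m)

BijOn : ∀ {A B : Set} → (A → Set) → (B → Set) → (A → B) → Set
BijOn {A} {B} P Q f =
  (∀ x → P x → Q (f x)) ×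
  (∀ x y → P x → P y → f x ≡ f y → x ≡ y) ×
  (∀ y → Q y → Σ A λ x → P x × f x ≡ y)

-- The whole argument rests on a criterion for acyclicity of the minors Mₖ = ₋A (M \ (Eₖ − N) / N)
-- with N independent: Mₖ is acyclic iff no circuit Y of M avoiding Eₖ − N becomes positive outside
-- N after reorienting A. One direction is immediate; for the other, such a Y is eliminated against
-- circuits with smaller support outside N until a support-minimal one, i.e. a positive circuit of
-- the contraction, remains. All cases of ψₖ and of its explicit inverse are then settled by
-- exhibiting or refuting such circuits. The delicate case is that N ∪ {eₖ} stays NBC: a broken
-- circuit through eₖ meets the complement of N in eₖ and its maximum only, and choosing between ±Y
-- and between A, A ∪ {eₖ} makes both of those signs positive, contradicting acyclicity.

module Submission where

open import Data.Bool using (Bool; true; false; not; _∧_; _∨_; if_then_else_; T)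
open import Data.Bool.Properties using (∨-comm; ∧-identityʳ; ∧-zeroʳ; ∨-identityʳ; ∨-zeroʳ; ∧-distribʳ-∨; T-≡; T-not-≡; T-∧; T?)
open import Data.Empty as Empty using (⊥-elim)
open import Data.Fin using (Fin; toℕ; zero; suc; _≟_)
open import Data.Fin.Properties using (toℕ-injective; toℕ<n)
open import Data.Fin.Subset using (Subset; ⊥; ⁅_⁆; _∈_; _⊆_; _∩_; _∪_; _─_; ∣_∣)
open import Data.Fin.Subset.Properties using (p⊂q⇒∣p∣<∣q∣; ∪-comm)
open import Data.List.Base as List using (List; map; filterᵇ; foldl)
open import Data.List.Properties using (map-∘; map-cong)
open import Data.List.Membership.Propositional using () renaming (_∈_ to _∈ˡ_)
open import Data.List.Membership.Propositional.Properties using (∈-map⁻; ∈-map⁺; ∈-filter⁺; ∈-filter⁻)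
open import Data.List.Relation.Unary.Any using (here; there)
open import Data.Nat using (ℕ; zero; suc; _<ᵇ_; _≤_; _<_; s≤s; s≤s⁻¹; z≤n; _+_)
open import Data.Nat.Properties using (≤-refl; <⇒≤; <-≤-trans; <⇒≱; ≮⇒≥; ≤∧≢⇒<; m<n⇒m<1+n; <ᵇ⇒<; <⇒<ᵇ; +-suc; +-identityʳ)
open import Data.Product using (_×_; _,_; proj₁; proj₂; Σ)
open import Data.Sum using (_⊎_; inj₁; inj₂; [_,_]′)
open import Data.Vec using ([]; _∷_; lookup)
open import Data.Vec.Properties using (lookup-zipWith; lookup-replicate; lookup∘tabulate; []=⇒lookup; lookup⇒[]=)
open import Function using (_∘_)
open import Function.Bundles using (_⇔_; mk⇔; Equivalence)
open import Relation.Binary.PropositionalEquality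
open import Relation.Nullary using (¬_; Dec; yes; no)
open import Relation.Nullary.Decidable using (does)

open import Defs

private variable n : ℕ

-- Subsets of Fin n, read pointwise

infixl 9 _!_
_!_ : Subset n → Fin n → Bool
p ! i = lookup p i

!-ext : {p q : Subset n} → (∀ i → p ! i ≡ q ! i) → p ≡ q
!-ext {p = []}    {[]}    h = refl
!-ext {p = x ∷ p} {y ∷ q} h = cong₂ _∷_ (h zero) (!-ext (h ∘ suc))

!-∪ : ∀ (p q : Subset n) i → (p ∪ q) ! i ≡ p ! i ∨ q ! i
!-∪ p q i = lookup-zipWith _∨_ i p q

!-∩ : ∀ (p q : Subset n) i → (p ∩ q) ! i ≡ p ! i ∧ q ! i
!-∩ p q i = lookup-zipWith _∧_ i p q

!-─ : ∀ (p q : Subset n) i → (p ─ q) ! i ≡ p ! i ∧ not (q ! i)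
!-─ (x ∷ p)     (true ∷ q)  zero    = sym (∧-zeroʳ x)
!-─ (x ∷ p)     (false ∷ q) zero    = sym (∧-identityʳ x)
!-─ (_ ∷ p)     (_ ∷ q)     (suc i) = !-─ p q i

!-⊥ : ∀ (i : Fin n) → ⊥ ! i ≡ false
!-⊥ i = lookup-replicate i false

!-⁅⁆ : ∀ (i j : Fin n) → ⁅ i ⁆ ! j ≡ does (j ≟ i)
!-⁅⁆ zero    zero    = refl
!-⁅⁆ zero    (suc j) = !-⊥ j
!-⁅⁆ (suc i) zero    = refl
!-⁅⁆ (suc i) (suc j) with j ≟ i | !-⁅⁆ i j
... | yes _ | eq = eq
... | no _  | eq = eq

∈⇒! : {p : Subset n} {i : Fin n} → i ∈ p → p ! i ≡ true
∈⇒! = []=⇒lookup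

!⇒∈ : {p : Subset n} {i : Fin n} → p ! i ≡ true → i ∈ p
!⇒∈ {p = p} {i} = lookup⇒[]= i p

true≢false : {b : Bool} → b ≡ true → b ≡ false → Empty.⊥
true≢false refl ()

module _ {e : Fin n} where

  ⁅⁆-≡ : ⁅ e ⁆ ! e ≡ true
  ⁅⁆-≡ rewrite !-⁅⁆ e e with e ≟ e
  ... | yes _ = refl
  ... | no e≢e = ⊥-elim (e≢e refl)

  ⁅⁆-≢ : ∀ {j} → j ≢ e → ⁅ e ⁆ ! j ≡ false
  ⁅⁆-≢ {j} j≢e rewrite !-⁅⁆ e j with j ≟ e
  ... | yes j≡e = ⊥-elim (j≢e j≡e)
  ... | no _    = refl

  ⁅⁆-true : ∀ {j} → ⁅ e ⁆ ! j ≡ true → j ≡ e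
  ⁅⁆-true {j} h with j ≟ e
  ... | yes j≡e = j≡e
  ... | no j≢e  = ⊥-elim (true≢false h (⁅⁆-≢ j≢e))

  ∪⁅⁆-≡ : ∀ (p : Subset n) → (p ∪ ⁅ e ⁆) ! e ≡ true
  ∪⁅⁆-≡ p rewrite !-∪ p ⁅ e ⁆ e | ⁅⁆-≡ = ∨-zeroʳ (p ! e)

  ∪⁅⁆-≢ : ∀ (p : Subset n) {j} → j ≢ e → (p ∪ ⁅ e ⁆) ! j ≡ p ! j
  ∪⁅⁆-≢ p {j} j≢e rewrite !-∪ p ⁅ e ⁆ j | ⁅⁆-≢ j≢e = ∨-identityʳ (p ! j)

  ─⁅⁆-≡ : ∀ (p : Subset n) → (p ─ ⁅ e ⁆) ! e ≡ false
  ─⁅⁆-≡ p rewrite !-─ p ⁅ e ⁆ e | ⁅⁆-≡ = ∧-zeroʳ (p ! e)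

  ─⁅⁆-≢ : ∀ (p : Subset n) {j} → j ≢ e → (p ─ ⁅ e ⁆) ! j ≡ p ! j
  ─⁅⁆-≢ p {j} j≢e rewrite !-─ p ⁅ e ⁆ j | ⁅⁆-≢ j≢e = ∧-identityʳ (p ! j)

module _ (p q : Subset n) (i : Fin n) where

  ∪-true : (p ∪ q) ! i ≡ true → p ! i ≡ true ⊎ q ! i ≡ true
  ∪-true h rewrite !-∪ p q i with p ! i
  ... | true  = inj₁ refl
  ... | false = inj₂ h

  ∪-trueˡ : p ! i ≡ true → (p ∪ q) ! i ≡ true
  ∪-trueˡ h rewrite !-∪ p q i | h = refl

  ∪-trueʳ : q ! i ≡ true → (p ∪ q) ! i ≡ true
  ∪-trueʳ h rewrite !-∪ p q i | h = ∨-zeroʳ (p ! i)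

  ─-true : (p ─ q) ! i ≡ true → p ! i ≡ true × q ! i ≡ false
  ─-true h rewrite !-─ p q i with p ! i | q ! i
  ... | true | false = refl , refl

  ─-intro : p ! i ≡ true → q ! i ≡ false → (p ─ q) ! i ≡ true
  ─-intro hp hq rewrite !-─ p q i | hp | hq = refl

  ─-falseˡ : p ! i ≡ false → (p ─ q) ! i ≡ false
  ─-falseˡ h rewrite !-─ p q i | h = refl

  ─-falseʳ : q ! i ≡ true → (p ─ q) ! i ≡ false
  ─-falseʳ h rewrite !-─ p q i | h = ∧-zeroʳ (p ! i)

  ─-false : (p ─ q) ! i ≡ false → q ! i ≡ false → p ! i ≡ false
  ─-false h hq rewrite !-─ p q i | hq = trans (sym (∧-identityʳ (p ! i))) h

module _ (e : Fin n) (p : Subset n) where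

  ─⁅⁆∪⁅⁆ : p ! e ≡ true → (p ─ ⁅ e ⁆) ∪ ⁅ e ⁆ ≡ p
  ─⁅⁆∪⁅⁆ pe = !-ext λ i → at i (i ≟ e)
    where
    at : ∀ i → Dec (i ≡ e) → ((p ─ ⁅ e ⁆) ∪ ⁅ e ⁆) ! i ≡ p ! i
    at i (yes refl) = trans (∪⁅⁆-≡ (p ─ ⁅ e ⁆)) (sym pe)
    at i (no i≢e)   = trans (∪⁅⁆-≢ (p ─ ⁅ e ⁆) i≢e) (─⁅⁆-≢ p i≢e)

  ∪⁅⁆─⁅⁆ : p ! e ≡ false → (p ∪ ⁅ e ⁆) ─ ⁅ e ⁆ ≡ p
  ∪⁅⁆─⁅⁆ pe = !-ext λ i → at i (i ≟ e)
    where
    at : ∀ i → Dec (i ≡ e) → ((p ∪ ⁅ e ⁆) ─ ⁅ e ⁆) ! i ≡ p ! i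
    at i (yes refl) = trans (─⁅⁆-≡ (p ∪ ⁅ e ⁆)) (sym pe)
    at i (no i≢e)   = trans (─⁅⁆-≢ (p ∪ ⁅ e ⁆) i≢e) (∪⁅⁆-≢ p i≢e)

!-∪─ : ∀ (p q S : Subset n) i → ((p ∪ q) ─ S) ! i ≡ (p ! i ∨ q ! i) ∧ not (S ! i)
!-∪─ p q S i = trans (!-─ (p ∪ q) S i) (cong (_∧ not (S ! i)) (!-∪ p q i))

infix 4 _⊑_
_⊑_ : Subset n → Subset n → Set
p ⊑ q = ∀ i → p ! i ≡ true → q ! i ≡ true

Disjoint : Subset n → Subset n → Set
Disjoint p q = ∀ i → p ! i ≡ true → q ! i ≡ false

Inhabited : Subset n → Set
Inhabited {n} p = Σ (Fin n) λ i → p ! i ≡ true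

Void : Subset n → Set
Void p = ∀ i → p ! i ≡ false

⊑⇒⊆ : ∀ (p q : Subset n) → p ⊑ q → p ⊆ q
⊑⇒⊆ p q h x = !⇒∈ (h _ (∈⇒! x))

⊆⇒⊑ : ∀ (p q : Subset n) → p ⊆ q → p ⊑ q
⊆⇒⊑ p q h i x = ∈⇒! (h (!⇒∈ x))

─-mono : ∀ {p q : Subset n} (S : Subset n) → p ⊑ q → p ─ S ⊑ q ─ S
─-mono {p = p} {q = q} S p⊑q i x = let (xp , xS) = ─-true p S i x in ─-intro q S i (p⊑q i xp) xS

Disjoint-anti : ∀ {x p q : Subset n} → Disjoint x q → p ⊑ q → Disjoint x p
Disjoint-anti {p = p} d p⊑q i xi with p ! i in pi
... | false = refl
... | true  = ⊥-elim (true≢false (p⊑q i pi) (d i xi))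

Disjoint-sym : ∀ {p q : Subset n} → Disjoint p q → Disjoint q p
Disjoint-sym {p = p} d i qi with p ! i in pi
... | false = refl
... | true  = ⊥-elim (true≢false qi (d i pi))

∩≡⊥⇒Disjoint : ∀ (p q : Subset n) → p ∩ q ≡ ⊥ → Disjoint p q
∩≡⊥⇒Disjoint p q h i pi with q ! i in qi
... | false = refl
... | true  = ⊥-elim (true≢false (trans (!-∩ p q i) (cong₂ _∧_ pi qi))
                                 (trans (cong (_! i) h) (!-⊥ i)))

Disjoint⇒∩≡⊥ : ∀ (p q : Subset n) → Disjoint p q → p ∩ q ≡ ⊥
Disjoint⇒∩≡⊥ p q d = !-ext λ i → trans (!-∩ p q i) (trans (meet i) (sym (!-⊥ i)))
  where
  meet : ∀ i → (p ! i ∧ q ! i) ≡ false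
  meet i with p ! i in pi
  ... | false = refl
  ... | true  = d i pi

Inhabited⇒¬Void : {p : Subset n} → Inhabited p → ¬ Void p
Inhabited⇒¬Void (i , pi) v = true≢false pi (v i)

Void⊎Inhabited : ∀ (p : Subset n) → Void p ⊎ Inhabited p
Void⊎Inhabited []          = inj₁ λ ()
Void⊎Inhabited (true ∷ p)  = inj₂ (zero , refl)
Void⊎Inhabited (false ∷ p) with Void⊎Inhabited p
... | inj₁ v       = inj₁ λ { zero → refl ; (suc i) → v i }
... | inj₂ (i , h) = inj₂ (suc i , h)

Void⇒≡⊥ : {p : Subset n} → Void p → p ≡ ⊥
Void⇒≡⊥ v = !-ext λ i → trans (v i) (sym (!-⊥ i))

maximum : ∀ (p : Subset n) → Inhabited p →
          Σ (Fin n) λ e → p ! e ≡ true × (∀ f → p ! f ≡ true → toℕ f ≤ toℕ e)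
maximum (x ∷ p) inh with Void⊎Inhabited p
... | inj₂ inh′ = let (e , pe , max) = maximum p inh′ in suc e , pe , bound e max
  where
  bound : ∀ e → (∀ f → p ! f ≡ true → toℕ f ≤ toℕ e) → ∀ f → (x ∷ p) ! f ≡ true → toℕ f ≤ toℕ (suc e)
  bound e max zero    _  = z≤n
  bound e max (suc f) pf = s≤s (max f pf)
... | inj₁ v = zero , head inh , λ { zero _ → z≤n ; (suc f) pf → ⊥-elim (true≢false pf (v f)) }
  where
  head : Inhabited (x ∷ p) → x ≡ true
  head (zero , h)  = h
  head (suc i , h) = ⊥-elim (true≢false h (v i))

isEmptyᵇ-Void : ∀ (p : Subset n) → T (isEmptyᵇ p) ⇔ Void p
isEmptyᵇ-Void p = mk⇔ (to p) (from p)
  where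
  to : ∀ {n} (p : Subset n) → T (isEmptyᵇ p) → Void p
  to (false ∷ p) h zero    = refl
  to (false ∷ p) h (suc i) = to p h i
  from : ∀ {n} (p : Subset n) → Void p → T (isEmptyᵇ p)
  from []      v = _
  from (x ∷ p) v with v zero
  ... | refl = from p (v ∘ suc)

¬isEmptyᵇ-Inhabited : ∀ (p : Subset n) → T (not (isEmptyᵇ p)) ⇔ Inhabited p
¬isEmptyᵇ-Inhabited p = mk⇔ to from
  where
  to : T (not (isEmptyᵇ p)) → Inhabited p
  to h with Void⊎Inhabited p
  ... | inj₂ inh = inh
  ... | inj₁ v   = ⊥-elim (true≢false (Equivalence.to T-≡ (Equivalence.from (isEmptyᵇ-Void p) v))
                                      (Equivalence.to T-not-≡ h))
  from : Inhabited p → T (not (isEmptyᵇ p))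
  from inh with isEmptyᵇ p in eq
  ... | false = _
  ... | true  = Inhabited⇒¬Void {p = p} inh (Equivalence.to (isEmptyᵇ-Void p) (Equivalence.from T-≡ eq))

⊆ᵇ-⊑ : ∀ (p q : Subset n) → T (p ⊆ᵇ q) ⇔ p ⊑ q
⊆ᵇ-⊑ p q = mk⇔ (to p q) (from p q)
  where
  to : ∀ {n} (p q : Subset n) → T (p ⊆ᵇ q) → p ⊑ q
  to (true ∷ p)  (true ∷ q) h zero    _ = refl
  to (true ∷ p)  (true ∷ q) h (suc i) x = to p q h i x
  to (false ∷ p) (y ∷ q)    h (suc i) x = to p q h i x
  from : ∀ {n} (p q : Subset n) → p ⊑ q → T (p ⊆ᵇ q)
  from []          []      _ = _
  from (true ∷ p)  (y ∷ q) h with h zero refl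
  ... | refl = from p q (h ∘ suc)
  from (false ∷ p) (y ∷ q) h = from p q (h ∘ suc)

∈ᵇ-! : ∀ (e : Fin n) A → (e ∈ᵇ A) ≡ A ! e
∈ᵇ-! zero    (a ∷ A) = trans (cong (λ b → not (not a ∧ b)) (Equivalence.to T-≡ ⊥∩A-empty)) (lemma a)
  where
  ⊥∩A-empty : T (isEmptyᵇ (⊥ ∩ A))
  ⊥∩A-empty = Equivalence.from (isEmptyᵇ-Void (⊥ ∩ A)) λ i → trans (!-∩ ⊥ A i) (cong (_∧ A ! i) (!-⊥ i))
  lemma : ∀ a → not (not a ∧ true) ≡ a
  lemma true  = refl
  lemma false = refl
∈ᵇ-! (suc e) (a ∷ A) = ∈ᵇ-! e A

-- Signed sets and reorientation

mux≡if : ∀ p q r → ((p ∧ not r) ∨ (q ∧ r)) ≡ (if r then q else p)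
mux≡if p q true  = cong₂ _∨_ (∧-zeroʳ p) (∧-identityʳ q)
mux≡if p q false = trans (cong₂ _∨_ (∧-identityʳ p) (∧-zeroʳ q)) (∨-identityʳ p)

module _ (R : Subset n) where

  pos-reorient : ∀ X i → pos (reorientSet R X) ! i ≡ (if R ! i then neg X ! i else pos X ! i)
  pos-reorient (p , q) i
    rewrite !-∪ (p ─ R) (q ∩ R) i | !-─ p R i | !-∩ q R i = mux≡if (p ! i) (q ! i) (R ! i)

  neg-reorient : ∀ X i → neg (reorientSet R X) ! i ≡ (if R ! i then pos X ! i else neg X ! i)
  neg-reorient (p , q) i
    rewrite !-∪ (q ─ R) (p ∩ R) i | !-─ q R i | !-∩ p R i = mux≡if (q ! i) (p ! i) (R ! i)

supp-! : ∀ (X : SignedSet n) i → supp X ! i ≡ pos X ! i ∨ neg X ! i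
supp-! X = !-∪ (pos X) (neg X)

supp-reorient : ∀ (R : Subset n) X → supp (reorientSet R X) ≡ supp X
supp-reorient R X = !-ext λ i → begin
  supp (reorientSet R X) ! i                          ≡⟨ supp-! (reorientSet R X) i ⟩
  pos (reorientSet R X) ! i ∨ neg (reorientSet R X) ! i
    ≡⟨ cong₂ _∨_ (pos-reorient R X i) (neg-reorient R X i) ⟩
  (if R ! i then neg X ! i else pos X ! i) ∨ (if R ! i then pos X ! i else neg X ! i)
    ≡⟨ if-swap (R ! i) (pos X ! i) (neg X ! i) ⟩
  pos X ! i ∨ neg X ! i                               ≡⟨ supp-! X i ⟨
  supp X ! i                                          ∎
  where
  open ≡-Reasoning
  if-swap : ∀ r a b → (if r then b else a) ∨ (if r then a else b) ≡ a ∨ b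
  if-swap true  a b = ∨-comm b a
  if-swap false a b = refl

supp-opp : ∀ (X : SignedSet n) → supp (opp X) ≡ supp X
supp-opp X = !-ext λ i → trans (supp-! (opp X) i) (trans (∨-comm (neg X ! i) (pos X ! i)) (sym (supp-! X i)))

module _ (X : SignedSet n) (i : Fin n) where

  pos⇒supp : pos X ! i ≡ true → supp X ! i ≡ true
  pos⇒supp = ∪-trueˡ (pos X) (neg X) i

  neg⇒supp : neg X ! i ≡ true → supp X ! i ≡ true
  neg⇒supp = ∪-trueʳ (pos X) (neg X) i

  supp⇒pos⊎neg : supp X ! i ≡ true → pos X ! i ≡ true ⊎ neg X ! i ≡ true
  supp⇒pos⊎neg = ∪-true (pos X) (neg X) i

  supp⇒pos : supp X ! i ≡ true → neg X ! i ≡ false → pos X ! i ≡ true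
  supp⇒pos s nX with supp⇒pos⊎neg s
  ... | inj₁ p = p
  ... | inj₂ q = ⊥-elim (true≢false q nX)

  supp⇒neg : supp X ! i ≡ true → pos X ! i ≡ false → neg X ! i ≡ true
  supp⇒neg s pX with supp⇒pos⊎neg s
  ... | inj₁ p = ⊥-elim (true≢false p pX)
  ... | inj₂ q = q

  ¬supp⇒¬neg : supp X ! i ≡ false → neg X ! i ≡ false
  ¬supp⇒¬neg s with neg X ! i in q
  ... | false = refl
  ... | true  = ⊥-elim (true≢false (neg⇒supp q) s)

circuit-signs-disjoint : ∀ (M : OrientedMatroid n) {X} → X ∈ˡ circuits M → Disjoint (pos X) (neg X)
circuit-signs-disjoint M {X} X∈ = ∩≡⊥⇒Disjoint (pos X) (neg X) (signed M X X∈)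

module _ (R : Subset n) where

  private
    ρ : SignedSet n → SignedSet n
    ρ = reorientSet R

  reorient-signs-disjoint : ∀ X → Disjoint (pos X) (neg X) → Disjoint (pos (ρ X)) (neg (ρ X))
  reorient-signs-disjoint X d i h rewrite pos-reorient R X i | neg-reorient R X i with R ! i
  ... | true  = Disjoint-sym {p = pos X} {neg X} d i h
  ... | false = d i h

  reorient-⊑ : ∀ S Z A B → pos Z ⊑ (pos A ∪ pos B) ─ S → neg Z ⊑ (neg A ∪ neg B) ─ S →
               pos (ρ Z) ⊑ (pos (ρ A) ∪ pos (ρ B)) ─ S
  reorient-⊑ S Z A B hp hn i h
    rewrite !-∪─ (pos (ρ A)) (pos (ρ B)) S i | pos-reorient R A i | pos-reorient R B i | pos-reorient R Z i
    with R ! i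
  ... | true  = trans (sym (!-∪─ (neg A) (neg B) S i)) (hn i h)
  ... | false = trans (sym (!-∪─ (pos A) (pos B) S i)) (hp i h)

  module _ {X : SignedSet n} {i : Fin n} where

    pos-reorient-∉ : R ! i ≡ false → pos (ρ X) ! i ≡ pos X ! i
    pos-reorient-∉ r = trans (pos-reorient R X i) (cong (if_then neg X ! i else pos X ! i) r)

    pos-reorient-∈ : R ! i ≡ true → pos (ρ X) ! i ≡ neg X ! i
    pos-reorient-∈ r = trans (pos-reorient R X i) (cong (if_then neg X ! i else pos X ! i) r)

    neg-reorient-∉ : R ! i ≡ false → neg (ρ X) ! i ≡ neg X ! i
    neg-reorient-∉ r = trans (neg-reorient R X i) (cong (if_then pos X ! i else neg X ! i) r)

    neg-reorient-∈ : R ! i ≡ true → neg (ρ X) ! i ≡ pos X ! i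
    neg-reorient-∈ r = trans (neg-reorient R X i) (cong (if_then pos X ! i else neg X ! i) r)

¬supp⇒¬neg-reorient : ∀ (A : Subset n) Y i → supp Y ! i ≡ false → neg (reorientSet A Y) ! i ≡ false
¬supp⇒¬neg-reorient A Y i s = ¬supp⇒¬neg (reorientSet A Y) i (trans (cong (_! i) (supp-reorient A Y)) s)

module _ (A : Subset n) (Y : SignedSet n) (i : Fin n) where

  neg-reorient-cong : ∀ A′ → (supp Y ! i ≡ true → A ! i ≡ A′ ! i) →
                      neg (reorientSet A Y) ! i ≡ neg (reorientSet A′ Y) ! i
  neg-reorient-cong A′ h with supp Y ! i in s
  ... | true  = trans (neg-reorient A Y i) (trans (cong (if_then pos Y ! i else neg Y ! i) (h refl))
                                                  (sym (neg-reorient A′ Y i)))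
  ... | false = trans (¬supp⇒¬neg-reorient A Y i s) (sym (¬supp⇒¬neg-reorient A′ Y i s))

reorientSet-∪ : ∀ (A B : Subset n) X → Disjoint B A → reorientSet B (reorientSet A X) ≡ reorientSet (A ∪ B) X
reorientSet-∪ A B X d = cong₂ _,_
  (!-ext λ i → begin
    pos (reorientSet B (reorientSet A X)) ! i
      ≡⟨ pos-reorient B (reorientSet A X) i ⟩
    (if B ! i then neg (reorientSet A X) ! i else pos (reorientSet A X) ! i)
      ≡⟨ cong₂ (if B ! i then_else_) (neg-reorient A X i) (pos-reorient A X i) ⟩
    (if B ! i then (if A ! i then pos X ! i else neg X ! i) else (if A ! i then neg X ! i else pos X ! i))
      ≡⟨ compose i (pos X ! i) (neg X ! i) ⟩
    (if (A ∪ B) ! i then neg X ! i else pos X ! i)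
      ≡⟨ pos-reorient (A ∪ B) X i ⟨
    pos (reorientSet (A ∪ B) X) ! i ∎)
  (!-ext λ i → begin
    neg (reorientSet B (reorientSet A X)) ! i
      ≡⟨ neg-reorient B (reorientSet A X) i ⟩
    (if B ! i then pos (reorientSet A X) ! i else neg (reorientSet A X) ! i)
      ≡⟨ cong₂ (if B ! i then_else_) (pos-reorient A X i) (neg-reorient A X i) ⟩
    (if B ! i then (if A ! i then neg X ! i else pos X ! i) else (if A ! i then pos X ! i else neg X ! i))
      ≡⟨ compose i (neg X ! i) (pos X ! i) ⟩
    (if (A ∪ B) ! i then pos X ! i else neg X ! i)
      ≡⟨ neg-reorient (A ∪ B) X i ⟨
    neg (reorientSet (A ∪ B) X) ! i ∎)
  where
  open ≡-Reasoning
  compose : ∀ i (x y : Bool) →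
    (if B ! i then (if A ! i then x else y) else (if A ! i then y else x)) ≡ (if (A ∪ B) ! i then y else x)
  compose i x y rewrite !-∪ A B i with A ! i in a | B ! i in b
  ... | true  | true  = ⊥-elim (true≢false a (d i b))
  ... | true  | false = refl
  ... | false | true  = refl
  ... | false | false = refl

reorientation : Subset n → OrientedMatroid n → OrientedMatroid n
reorientation {n} R M = record
  { circuits = reorient R (circuits M)
  ; signed   = signed′
  ; C0       = C0′
  ; C1       = C1′
  ; C2       = C2′
  ; C3       = C3′
  }
  where
  ρ = reorientSet R
  C = reorient R (circuits M)

  signed′ : ∀ X → X ∈ˡ C → pos X ∩ neg X ≡ ⊥
  signed′ X X∈ with ∈-map⁻ ρ X∈
  ... | X₀ , X₀∈ , refl = Disjoint⇒∩≡⊥ (pos X) (neg X)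
    (reorient-signs-disjoint R X₀ (circuit-signs-disjoint M X₀∈))

  C0′ : ∀ X → X ∈ˡ C → supp X ≢ ⊥
  C0′ X X∈ with ∈-map⁻ ρ X∈
  ... | X₀ , X₀∈ , refl = λ eq → C0 M X₀ X₀∈ (trans (sym (supp-reorient R X₀)) eq)

  C1′ : ∀ X → X ∈ˡ C → opp X ∈ˡ C
  C1′ X X∈ with ∈-map⁻ ρ X∈
  ... | X₀ , X₀∈ , refl = ∈-map⁺ ρ (C1 M X₀ X₀∈)

  C2′ : ∀ X Y → X ∈ˡ C → Y ∈ˡ C → supp X ⊆ supp Y → (X ≡ Y) ⊎ (X ≡ opp Y)
  C2′ X Y X∈ Y∈ sub with ∈-map⁻ ρ X∈ | ∈-map⁻ ρ Y∈
  ... | X₀ , X₀∈ , refl | Y₀ , Y₀∈ , refl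
    with C2 M X₀ Y₀ X₀∈ Y₀∈ (subst₂ _⊆_ (supp-reorient R X₀) (supp-reorient R Y₀) sub)
  ... | inj₁ eq = inj₁ (cong ρ eq)
  ... | inj₂ eq = inj₂ (cong ρ eq)

  reoriented-elimination : ∀ e Z X Y → pos Z ⊆ (pos X ∪ pos Y) ─ ⁅ e ⁆ → neg Z ⊆ (neg X ∪ neg Y) ─ ⁅ e ⁆ →
    pos (ρ Z) ⊆ (pos (ρ X) ∪ pos (ρ Y)) ─ ⁅ e ⁆ × neg (ρ Z) ⊆ (neg (ρ X) ∪ neg (ρ Y)) ─ ⁅ e ⁆
  reoriented-elimination e Z X Y hp hn =
      ⊑⇒⊆ _ _ (reorient-⊑ R ⁅ e ⁆ Z X Y (⊆⇒⊑ _ _ hp) (⊆⇒⊑ _ _ hn))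
    , ⊑⇒⊆ _ _ (reorient-⊑ R ⁅ e ⁆ (opp Z) (opp X) (opp Y) (⊆⇒⊑ _ _ hn) (⊆⇒⊑ _ _ hp))

  C3′ : ∀ X Y e → X ∈ˡ C → Y ∈ˡ C → X ≢ opp Y → e ∈ pos X → e ∈ neg Y →
        Σ (SignedSet n) λ Z → Z ∈ˡ C × (pos Z ⊆ ((pos X ∪ pos Y) ─ ⁅ e ⁆)) × (neg Z ⊆ ((neg X ∪ neg Y) ─ ⁅ e ⁆))
  C3′ X Y e X∈ Y∈ X≢-Y e⁺ e⁻ with ∈-map⁻ ρ X∈ | ∈-map⁻ ρ Y∈
  ... | X₀ , X₀∈ , refl | Y₀ , Y₀∈ , refl with R ! e in Re
  ... | false =
    let (Z₀ , Z₀∈ , hp , hn) = C3 M X₀ Y₀ e X₀∈ Y₀∈ (X≢-Y ∘ cong ρ)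
          (!⇒∈ (trans (sym (pos-reorient-∉ R {X₀} Re)) (∈⇒! e⁺)))
          (!⇒∈ (trans (sym (neg-reorient-∉ R {Y₀} Re)) (∈⇒! e⁻)))
    in ρ Z₀ , ∈-map⁺ ρ Z₀∈ , reoriented-elimination e Z₀ X₀ Y₀ hp hn
  ... | true =
    let (Z₀ , Z₀∈ , hp , hn) = C3 M Y₀ X₀ e Y₀∈ X₀∈ (λ eq → X≢-Y (cong (ρ ∘ opp) (sym eq)))
          (!⇒∈ (trans (sym (neg-reorient-∈ R {Y₀} Re)) (∈⇒! e⁻)))
          (!⇒∈ (trans (sym (pos-reorient-∈ R {X₀} Re)) (∈⇒! e⁺)))
    in ρ Z₀ , ∈-map⁺ ρ Z₀∈ ,
       reoriented-elimination e Z₀ X₀ Y₀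
         (subst (λ u → pos Z₀ ⊆ u ─ ⁅ e ⁆) (∪-comm (pos Y₀) (pos X₀)) hp)
         (subst (λ u → neg Z₀ ⊆ u ─ ⁅ e ⁆) (∪-comm (neg Y₀) (neg X₀)) hn)

-- Deletion, contraction and acyclicity

module _ {A : Set} (p : A → Bool) where

  all-sound : ∀ {xs x} → T (all p xs) → x ∈ˡ xs → T (p x)
  all-sound {y List.∷ _} h (here refl) = proj₁ (Equivalence.to T-∧ h)
  all-sound {y List.∷ _} h (there x∈) = all-sound (proj₂ (Equivalence.to T-∧ h)) x∈

  all-complete : ∀ xs → (∀ {x} → x ∈ˡ xs → T (p x)) → T (all p xs)
  all-complete List.[]       h = _
  all-complete (x List.∷ xs) h = Equivalence.from T-∧ (h (here refl) , all-complete xs (h ∘ there))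

  all-counterexample : ∀ xs → ¬ T (all p xs) → Σ A λ x → x ∈ˡ xs × ¬ T (p x)
  all-counterexample List.[]       h = ⊥-elim (h _)
  all-counterexample (x List.∷ xs) h with p x in px
  ... | false = x , here refl , λ t → subst T px t
  ... | true  = let (y , y∈ , ¬py) = all-counterexample xs h in y , there y∈ , ¬py

∈-filterᵇ⁺ : ∀ {A : Set} (p : A → Bool) {xs x} → x ∈ˡ xs → T (p x) → x ∈ˡ filterᵇ p xs
∈-filterᵇ⁺ p = ∈-filter⁺ (T? ∘ p)

∈-filterᵇ⁻ : ∀ {A : Set} (p : A → Bool) {xs x} → x ∈ˡ filterᵇ p xs → x ∈ˡ xs × T (p x)
∈-filterᵇ⁻ p = ∈-filter⁻ (T? ∘ p)

module _ {A B : Set} {f : A → B} where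

  filterᵇ-map : ∀ {p : B → Bool} {q : A → Bool} → (∀ x → p (f x) ≡ q x) →
                ∀ xs → filterᵇ p (map f xs) ≡ map f (filterᵇ q xs)
  filterᵇ-map         h List.[]       = refl
  filterᵇ-map {p} {q} h (x List.∷ xs) with p (f x) | q x | h x
  ... | true  | true  | refl = cong (f x List.∷_) (filterᵇ-map h xs)
  ... | false | false | refl = filterᵇ-map h xs

  all-map : ∀ {p : B → Bool} {q : A → Bool} → (∀ x → p (f x) ≡ q x) →
            ∀ xs → all p (map f xs) ≡ all q xs
  all-map h List.[]       = refl
  all-map h (x List.∷ xs) = cong₂ _∧_ (h x) (all-map h xs)

Void-∩⇔Disjoint : ∀ (p q : Subset n) → Void (p ∩ q) ⇔ Disjoint p q
Void-∩⇔Disjoint p q = mk⇔ to from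
  where
  to : Void (p ∩ q) → Disjoint p q
  to v i pi = trans (sym (cong (_∧ q ! i) pi)) (trans (sym (!-∩ p q i)) (v i))
  from : Disjoint p q → Void (p ∩ q)
  from d i with p ! i in pi | !-∩ p q i
  ... | false | eq = eq
  ... | true  | eq = trans eq (d i pi)

module _ {S : Subset n} {L : List (SignedSet n)} {Y : SignedSet n} where

  ∈-delete⁻ : Y ∈ˡ delete S L → Y ∈ˡ L × Disjoint (supp Y) S
  ∈-delete⁻ Y∈ = let (Y∈L , t) = ∈-filterᵇ⁻ _ Y∈ in
    Y∈L , Equivalence.to (Void-∩⇔Disjoint (supp Y) S) (Equivalence.to (isEmptyᵇ-Void (supp Y ∩ S)) t)

  ∈-delete⁺ : Y ∈ˡ L → Disjoint (supp Y) S → Y ∈ˡ delete S L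
  ∈-delete⁺ Y∈L d = ∈-filterᵇ⁺ _ Y∈L
    (Equivalence.from (isEmptyᵇ-Void (supp Y ∩ S)) (Equivalence.from (Void-∩⇔Disjoint (supp Y) S) d))

infix 4 _⊏_
_⊏_ : Subset n → Subset n → Set
p ⊏ q = p ⊑ q × Σ _ λ i → q ! i ≡ true × p ! i ≡ false

⊏⇒∣∣< : ∀ (p q : Subset n) → p ⊏ q → ∣ p ∣ < ∣ q ∣
⊏⇒∣∣< p q (p⊑q , i , qi , pi) =
  p⊂q⇒∣p∣<∣q∣ {p = p} {q} (⊑⇒⊆ p q p⊑q , i , !⇒∈ qi , λ i∈p → true≢false (∈⇒! i∈p) pi)

⊆ᵇ-counterexample : ∀ (p q : Subset n) → ¬ T (p ⊆ᵇ q) → Σ _ λ i → p ! i ≡ true × q ! i ≡ false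
⊆ᵇ-counterexample []          []          h = ⊥-elim (h _)
⊆ᵇ-counterexample (true ∷ p)  (false ∷ q) h = zero , refl , refl
⊆ᵇ-counterexample (true ∷ p)  (true ∷ q)  h = let (i , pi , qi) = ⊆ᵇ-counterexample p q h in suc i , pi , qi
⊆ᵇ-counterexample (false ∷ p) (y ∷ q)     h = let (i , pi , qi) = ⊆ᵇ-counterexample p q h in suc i , pi , qi

cut : Subset n → SignedSet n → SignedSet n
cut S Y = (pos Y ─ S) , (neg Y ─ S)

supp-cut : ∀ (S : Subset n) Y → supp (cut S Y) ≡ supp Y ─ S
supp-cut S Y = !-ext λ i →
  trans (!-∪ (pos Y ─ S) (neg Y ─ S) i)
  (trans (cong₂ _∨_ (!-─ (pos Y) S i) (!-─ (neg Y) S i))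
  (trans (sym (∧-distribʳ-∨ (not (S ! i)) (pos Y ! i) (neg Y ! i)))
  (trans (cong (_∧ not (S ! i)) (sym (supp-! Y i))) (sym (!-─ (supp Y) S i)))))

-- `contract S L` unfolds to `filterᵇ (minimalIn (restrictions S L)) (restrictions S L)`
minimalIn : List (SignedSet n) → SignedSet n → Bool
minimalIn D Z = all (λ Z′ → not (supp Z′ ⊆ᵇ supp Z) ∨ (supp Z′ ==ᵇ supp Z)) D

module _ (S : Subset n) (L : List (SignedSet n)) where

  restrictions : List (SignedSet n)
  restrictions = map (cut S) (filterᵇ (λ Y → not (isEmptyᵇ (supp Y ─ S))) L)

  private
    minimalᵇ : SignedSet n → Bool
    minimalᵇ = minimalIn restrictions

  ∈-contract⁻ : ∀ {W} → W ∈ˡ contract S L → Σ (SignedSet n) λ Y → Y ∈ˡ L × W ≡ cut S Y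
  ∈-contract⁻ W∈ =
    let (W∈D , _)      = ∈-filterᵇ⁻ minimalᵇ W∈
        (Y , Y∈F , eq) = ∈-map⁻ (cut S) W∈D
    in Y , proj₁ (∈-filterᵇ⁻ _ Y∈F) , eq

  contract-or-smaller : ∀ {Y} → Y ∈ˡ L → Inhabited (supp Y ─ S) →
    cut S Y ∈ˡ contract S L ⊎ Σ (SignedSet n) λ Y′ → Y′ ∈ˡ L × supp Y′ ─ S ⊏ supp Y ─ S
  contract-or-smaller {Y} Y∈L inh with minimalᵇ (cut S Y) in min
  ... | true  = inj₁ (∈-filterᵇ⁺ minimalᵇ Y∈D (Equivalence.from T-≡ min))
    where
    Y∈D : cut S Y ∈ˡ restrictions
    Y∈D = ∈-map⁺ (cut S) (∈-filterᵇ⁺ _ Y∈L (Equivalence.from (¬isEmptyᵇ-Inhabited (supp Y ─ S)) inh))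
  ... | false with all-counterexample _ restrictions (λ t → subst T min t)
  ... | Z , Z∈D , ¬ok with ∈-map⁻ (cut S) Z∈D
  ... | Y′ , Y′∈F , refl =
    let (sub , ¬sup) = implies-false (supp (cut S Y′) ⊆ᵇ supp (cut S Y)) _ ¬ok
    in inj₂ (Y′ , proj₁ (∈-filterᵇ⁻ _ Y′∈F) , smaller sub ¬sup)
    where
    implies-false : ∀ a b → ¬ T (not a ∨ (a ∧ b)) → T a × ¬ T b
    implies-false true  true  h = ⊥-elim (h _)
    implies-false true  false h = _ , λ ()
    implies-false false b     h = ⊥-elim (h _)
    smaller : T (supp (cut S Y′) ⊆ᵇ supp (cut S Y)) → ¬ T (supp (cut S Y) ⊆ᵇ supp (cut S Y′)) →
              supp Y′ ─ S ⊏ supp Y ─ S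
    smaller sub ¬sup rewrite supp-cut S Y | supp-cut S Y′ =
      Equivalence.to (⊆ᵇ-⊑ (supp Y′ ─ S) (supp Y ─ S)) sub , ⊆ᵇ-counterexample (supp Y ─ S) (supp Y′ ─ S) ¬sup

module _ {L : List (SignedSet n)} where

  acyclic⇒neg-inhabited : T (acyclic L) → ∀ {X} → X ∈ˡ L → Inhabited (neg X)
  acyclic⇒neg-inhabited ac {X} X∈ =
    Equivalence.to (¬isEmptyᵇ-Inhabited (neg X)) (all-sound _ ac X∈)

  acyclic-intro : (∀ {X} → X ∈ˡ L → ¬ Void (neg X)) → T (acyclic L)
  acyclic-intro h = all-complete _ L λ {X} X∈ → Equivalence.from (¬isEmptyᵇ-Inhabited (neg X)) (inhabited X∈)
    where
    inhabited : ∀ {X} → X ∈ˡ L → Inhabited (neg X)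
    inhabited {X} X∈ with Void⊎Inhabited (neg X)
    ... | inj₁ v   = ⊥-elim (h X∈ v)
    ... | inj₂ inh = inh

  ¬acyclic⇒positive : ¬ T (acyclic L) → Σ (SignedSet n) λ X → X ∈ˡ L × Void (neg X)
  ¬acyclic⇒positive h =
    let (X , X∈ , ¬ne) = all-counterexample _ L h
    in X , X∈ , Equivalence.to (isEmptyᵇ-Void (neg X)) (¬T-not⇒T (isEmptyᵇ (neg X)) ¬ne)
    where
    ¬T-not⇒T : ∀ b → ¬ T (not b) → T b
    ¬T-not⇒T true  _ = _
    ¬T-not⇒T false h = ⊥-elim (h _)

module _ (R : Subset n) where

  private
    ρ : SignedSet n → SignedSet n
    ρ = reorientSet R

  cut-reorient : ∀ S X → cut S (ρ X) ≡ ρ (cut S X)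
  cut-reorient S X = cong₂ _,_
    (!-ext λ i → at (pos X) (neg X) (pos (ρ X)) (pos (ρ (cut S X))) i (pos-reorient R X i) (pos-reorient R (cut S X) i))
    (!-ext λ i → at (neg X) (pos X) (neg (ρ X)) (neg (ρ (cut S X))) i (neg-reorient R X i) (neg-reorient R (cut S X) i))
    where
    at : ∀ p q u v i → u ! i ≡ (if R ! i then q ! i else p ! i) →
         v ! i ≡ (if R ! i then (q ─ S) ! i else (p ─ S) ! i) → (u ─ S) ! i ≡ v ! i
    at p q u v i hu hv rewrite !-─ u S i | hu | hv | !-─ p S i | !-─ q S i with R ! i
    ... | true  = refl
    ... | false = refl

  delete-reorient : ∀ S L → delete S (reorient R L) ≡ reorient R (delete S L)
  delete-reorient S = filterᵇ-map λ X → cong (λ s → isEmptyᵇ (s ∩ S)) (supp-reorient R X)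

  restrictions-reorient : ∀ S L → restrictions S (reorient R L) ≡ reorient R (restrictions S L)
  restrictions-reorient S L = begin
    map (cut S) (filterᵇ _ (map ρ L))
      ≡⟨ cong (map (cut S)) (filterᵇ-map (λ X → cong (λ s → not (isEmptyᵇ (s ─ S))) (supp-reorient R X)) L) ⟩
    map (cut S) (map ρ F)               ≡⟨ map-∘ F ⟨
    map (cut S ∘ ρ) F                   ≡⟨ map-cong (cut-reorient S) F ⟩
    map (ρ ∘ cut S) F                   ≡⟨ map-∘ F ⟩
    map ρ (map (cut S) F)               ∎
    where
    open ≡-Reasoning
    F = filterᵇ (λ Y → not (isEmptyᵇ (supp Y ─ S))) L

  contract-reorient : ∀ S L → contract S (reorient R L) ≡ reorient R (contract S L)
  contract-reorient S L = begin
    filterᵇ (minimalIn (restrictions S (reorient R L))) (restrictions S (reorient R L))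
      ≡⟨ cong (λ D → filterᵇ (minimalIn D) D) (restrictions-reorient S L) ⟩
    filterᵇ (minimalIn (map ρ D)) (map ρ D)
      ≡⟨ filterᵇ-map minimal-invariant D ⟩
    map ρ (filterᵇ (minimalIn D) D)
      ∎
    where
    open ≡-Reasoning
    D = restrictions S L
    minimal-invariant : ∀ Z → minimalIn (map ρ D) (ρ Z) ≡ minimalIn D Z
    minimal-invariant Z =
      all-map (λ Z′ → cong₂ (λ s t → not (s ⊆ᵇ t) ∨ (s ==ᵇ t)) (supp-reorient R Z′) (supp-reorient R Z)) D

-- Positive circuits of a contraction

PositiveOutside : Subset n → SignedSet n → Set
PositiveOutside S Y = ∀ i → S ! i ≡ false → neg Y ! i ≡ false

PositiveOutside⇔Void : ∀ (S : Subset n) Y → PositiveOutside S Y ⇔ Void (neg Y ─ S)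
PositiveOutside⇔Void S Y = mk⇔ to from
  where
  to : PositiveOutside S Y → Void (neg Y ─ S)
  to pY i with S ! i in s
  ... | true  = ─-falseʳ (neg Y) S i s
  ... | false = ─-falseˡ (neg Y) S i (pY i s)
  from : Void (neg Y ─ S) → PositiveOutside S Y
  from v i s = ─-false (neg Y) S i (v i) s

module _ {S A : Subset n} {Y : SignedSet n} where

  PositiveOutside-intro : (∀ i → supp Y ! i ≡ true → S ! i ≡ false → neg (reorientSet A Y) ! i ≡ false) →
                          PositiveOutside S (reorientSet A Y)
  PositiveOutside-intro h i s with supp Y ! i in y
  ... | true  = h i y s
  ... | false = ¬supp⇒¬neg-reorient A Y i y

  PositiveOutside-cong : ∀ {A′} → (∀ i → supp Y ! i ≡ true → S ! i ≡ false → A ! i ≡ A′ ! i) →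
                         PositiveOutside S (reorientSet A Y) → PositiveOutside S (reorientSet A′ Y)
  PositiveOutside-cong {A′} h pY i s = trans (sym (neg-reorient-cong A Y i A′ (λ y → h i y s))) (pY i s)

Independent : OrientedMatroid n → Subset n → Set
Independent M S = ∀ X → X ∈ˡ circuits M → Inhabited (supp X ─ S)

elimination-supp : ∀ {Z X Y : SignedSet n} {e} →
  pos Z ⊆ (pos X ∪ pos Y) ─ ⁅ e ⁆ → neg Z ⊆ (neg X ∪ neg Y) ─ ⁅ e ⁆ →
  ∀ i → supp Z ! i ≡ true → (supp X ! i ≡ true ⊎ supp Y ! i ≡ true) × i ≢ e
elimination-supp {Z = Z} {X} {Y} {e} hp hn i zi with supp⇒pos⊎neg Z i zi
... | inj₁ p = let (xy , ¬e) = ─-true (pos X ∪ pos Y) ⁅ e ⁆ i (⊆⇒⊑ _ _ hp i p) in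
    [ inj₁ ∘ pos⇒supp X i , inj₂ ∘ pos⇒supp Y i ]′ (∪-true (pos X) (pos Y) i xy)
  , λ { refl → true≢false (⁅⁆-≡ {e = i}) ¬e }
... | inj₂ q = let (xy , ¬e) = ─-true (neg X ∪ neg Y) ⁅ e ⁆ i (⊆⇒⊑ _ _ hn i q) in
    [ inj₁ ∘ neg⇒supp X i , inj₂ ∘ neg⇒supp Y i ]′ (∪-true (neg X) (neg Y) i xy)
  , λ { refl → true≢false (⁅⁆-≡ {e = i}) ¬e }

module PositiveContraction (M : OrientedMatroid n) (D S : Subset n) (S-indep : Independent M S) where

  L : List (SignedSet n)
  L = delete D (circuits M)

  PositiveCircuit : Set
  PositiveCircuit = Σ (SignedSet n) λ W → W ∈ˡ contract S L × Void (neg W)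

  private
    ∈L⁻ : ∀ {Y} → Y ∈ˡ L → Y ∈ˡ circuits M × Disjoint (supp Y) D
    ∈L⁻ = ∈-delete⁻ {S = D} {circuits M}

    ∈L⁺ : ∀ {Y} → Y ∈ˡ circuits M → Disjoint (supp Y) D → Y ∈ˡ L
    ∈L⁺ = ∈-delete⁺ {S = D} {circuits M}

    opp∈L : ∀ {Z} → Z ∈ˡ L → opp Z ∈ˡ L
    opp∈L {Z} Z∈ = let (Z∈C , dZ) = ∈L⁻ Z∈ in
      ∈L⁺ (C1 M Z Z∈C) (subst (λ s → Disjoint s D) (sym (supp-opp Z)) dZ)

  -- Z is eliminated against Y until it becomes positive outside S (or its opposite does), while its
  -- support outside S stays strictly inside that of Y.
  descend : ∀ {Y} → Y ∈ˡ L → PositiveOutside S Y →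
    (∀ {Y′} → Y′ ∈ˡ L → PositiveOutside S Y′ → ∣ supp Y′ ─ S ∣ < ∣ supp Y ─ S ∣ → PositiveCircuit) →
    ∀ j {Z} → Z ∈ˡ L → supp Z ─ S ⊏ supp Y ─ S → ∣ neg Z ─ S ∣ < j → PositiveCircuit
  descend {Y} Y∈ pY IH (suc j) {Z} Z∈ Z⊏Y bound
    with Void⊎Inhabited (neg Z ─ S) | Void⊎Inhabited (pos Z ─ S)
  ... | inj₁ v | _ = IH Z∈ (Equivalence.from (PositiveOutside⇔Void S Z) v) (⊏⇒∣∣< (supp Z ─ S) (supp Y ─ S) Z⊏Y)
  ... | inj₂ _ | inj₁ v =
    IH (opp∈L Z∈) (Equivalence.from (PositiveOutside⇔Void S (opp Z)) v)
       (subst (λ s → ∣ s ─ S ∣ < ∣ supp Y ─ S ∣) (sym (supp-opp Z)) (⊏⇒∣∣< (supp Z ─ S) (supp Y ─ S) Z⊏Y))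
  ... | inj₂ (g , g∈) | inj₂ (h , h∈) =
    descend Y∈ pY IH j Z″∈L Z″⊏Y (<-≤-trans (⊏⇒∣∣< (neg Z″ ─ S) (neg Z ─ S) negZ″⊏negZ) (s≤s⁻¹ bound))
    where
    Y∈C = proj₁ (∈L⁻ Y∈)
    Z∈C = proj₁ (∈L⁻ Z∈)
    g∈negZ = proj₁ (─-true (neg Z) S g g∈)
    g∉S    = proj₂ (─-true (neg Z) S g g∈)
    h∈posZ = proj₁ (─-true (pos Z) S h h∈)
    h∉S    = proj₂ (─-true (pos Z) S h h∈)

    g∈suppY─S : (supp Y ─ S) ! g ≡ true
    g∈suppY─S = proj₁ Z⊏Y g (─-intro (supp Z) S g (neg⇒supp Z g g∈negZ) g∉S)

    g∈posY : pos Y ! g ≡ true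
    g∈posY = supp⇒pos Y g (proj₁ (─-true (supp Y) S g g∈suppY─S)) (pY g g∉S)

    Y≢-Z : Y ≢ opp Z
    Y≢-Z eq = true≢false (trans (cong (λ X → neg X ! h) eq) h∈posZ) (pY h h∉S)

    elim = C3 M Y Z g Y∈C Z∈C Y≢-Z (!⇒∈ g∈posY) (!⇒∈ g∈negZ)
    Z″  = proj₁ elim

    supp-Z″ : ∀ i → supp Z″ ! i ≡ true → (supp Y ! i ≡ true ⊎ supp Z ! i ≡ true) × i ≢ g
    supp-Z″ = elimination-supp (proj₁ (proj₂ (proj₂ elim))) (proj₂ (proj₂ (proj₂ elim)))

    g∉Z″ : supp Z″ ! g ≡ false
    g∉Z″ with supp Z″ ! g in z
    ... | false = refl
    ... | true  = ⊥-elim (proj₂ (supp-Z″ g z) refl)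

    Z″∈L : Z″ ∈ˡ L
    Z″∈L = ∈L⁺ (proj₁ (proj₂ elim)) λ i z →
      [ proj₂ (∈L⁻ Y∈) i , proj₂ (∈L⁻ Z∈) i ]′ (proj₁ (supp-Z″ i z))

    Z″⊏Y : supp Z″ ─ S ⊏ supp Y ─ S
    Z″⊏Y = inside , g , g∈suppY─S , ─-falseˡ (supp Z″) S g g∉Z″
      where
      inside : supp Z″ ─ S ⊑ supp Y ─ S
      inside i z with ─-true (supp Z″) S i z
      ... | zi , i∉S with proj₁ (supp-Z″ i zi)
      ... | inj₁ yi = ─-intro (supp Y) S i yi i∉S
      ... | inj₂ zi′ = proj₁ Z⊏Y i (─-intro (supp Z) S i zi′ i∉S)

    negZ″⊏negZ : neg Z″ ─ S ⊏ neg Z ─ S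
    negZ″⊏negZ = inside , g , g∈ , ─-falseˡ (neg Z″) S g (¬supp⇒¬neg Z″ g g∉Z″)
      where
      inside : neg Z″ ─ S ⊑ neg Z ─ S
      inside i z with ─-true (neg Z″) S i z
      ... | zi , i∉S with ∪-true (neg Y) (neg Z) i (proj₁ (─-true (neg Y ∪ neg Z) ⁅ g ⁆ i
                                                    (⊆⇒⊑ _ _ (proj₂ (proj₂ (proj₂ elim))) i zi)))
      ... | inj₁ yi  = ⊥-elim (true≢false yi (pY i i∉S))
      ... | inj₂ zi′ = ─-intro (neg Z) S i zi′ i∉S

  positive-circuit : ∀ k {Y} → Y ∈ˡ L → PositiveOutside S Y → ∣ supp Y ─ S ∣ < k → PositiveCircuit
  positive-circuit (suc k) {Y} Y∈ pY bound with contract-or-smaller S L Y∈ (S-indep Y (proj₁ (∈L⁻ Y∈)))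
  ... | inj₁ cutY∈ = cut S Y , cutY∈ , Equivalence.to (PositiveOutside⇔Void S Y) pY
  ... | inj₂ (Y′ , Y′∈ , Y′⊏Y) =
    descend Y∈ pY (λ Y″∈ pY″ lt → positive-circuit k Y″∈ pY″ (<-≤-trans lt (s≤s⁻¹ bound)))
            (suc ∣ neg Y′ ─ S ∣) Y′∈ Y′⊏Y ≤-refl

  contraction-positive-circuit : ∀ {Y} → Y ∈ˡ L → PositiveOutside S Y → PositiveCircuit
  contraction-positive-circuit Y∈ pY = positive-circuit _ Y∈ pY ≤-refl

acyclic-contraction⇒¬positive : ∀ (M : OrientedMatroid n) R D S → Independent M S →
  T (acyclic (reorient R (contract S (delete D (circuits M))))) →
  ∀ {Y} → Y ∈ˡ delete D (circuits M) → ¬ PositiveOutside S (reorientSet R Y)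
acyclic-contraction⇒¬positive M R D S S-indep ac {Y} Y∈ pY =
  Inhabited⇒¬Void {p = neg W} (acyclic⇒neg-inhabited ac W∈) W⁻
  where
  C = circuits M

  indep′ : Independent (reorientation R M) S
  indep′ X X∈ with ∈-map⁻ (reorientSet R) X∈
  ... | X₀ , X₀∈ , refl = subst (λ s → Inhabited (s ─ S)) (sym (supp-reorient R X₀)) (S-indep X₀ X₀∈)

  open PositiveContraction (reorientation R M) D S indep′

  positive = contraction-positive-circuit
    (subst (reorientSet R Y ∈ˡ_) (sym (delete-reorient R D C)) (∈-map⁺ (reorientSet R) Y∈)) pY
  W  = proj₁ positive
  W⁻ = proj₂ (proj₂ positive)

  W∈ : W ∈ˡ reorient R (contract S (delete D C))
  W∈ = subst (W ∈ˡ_) (trans (cong (contract S) (delete-reorient R D C)) (contract-reorient R S (delete D C)))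
             (proj₁ (proj₂ positive))

-- Acyclic minors and NBC sets

module _ (M : OrientedMatroid n) where

  Acyclic : ℕ → Subset n → Subset n → Set
  Acyclic k N A = T (acyclic (minorCircuits M k N A))

  -- a circuit of M \ (Eₖ − N) whose image in ₋A (M \ (Eₖ − N) / N) is a positive vector,
  -- which (by the positive-circuit lemma) contains a positive circuit of that minor
  CyclicWitness : ℕ → Subset n → Subset n → SignedSet n → Set
  CyclicWitness k N A Y =
    Y ∈ˡ circuits M × Disjoint (supp Y) (Eₖ k ─ N) × PositiveOutside N (reorientSet A Y)

  module _ {k : ℕ} {N A : Subset n} where

    acyclic⇒¬witness : Independent M N → Acyclic k N A → ∀ {Y} → ¬ CyclicWitness k N A Y
    acyclic⇒¬witness N-indep ac (Y∈ , dY , pY) =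
      acyclic-contraction⇒¬positive M A (Eₖ k ─ N) N N-indep ac
        (∈-delete⁺ {S = Eₖ k ─ N} {circuits M} Y∈ dY) pY

    positive⇒witness : ∀ {X} → X ∈ˡ minorCircuits M k N A → Void (neg X) →
                       Σ (SignedSet n) (CyclicWitness k N A)
    positive⇒witness X∈ v with ∈-map⁻ (reorientSet A) X∈
    ... | W , W∈ , refl with ∈-contract⁻ N (delete (Eₖ k ─ N) (circuits M)) W∈
    ... | Y , Y∈ , refl =
      let (Y∈C , dY) = ∈-delete⁻ {S = Eₖ k ─ N} {circuits M} Y∈ in
      Y , Y∈C , dY ,
      Equivalence.from (PositiveOutside⇔Void N (reorientSet A Y))
        (subst (λ Z → Void (neg Z)) (sym (cut-reorient A N Y)) v)

    ¬witness⇒acyclic : (∀ {Y} → ¬ CyclicWitness k N A Y) → Acyclic k N A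
    ¬witness⇒acyclic h = acyclic-intro λ X∈ v → h (proj₂ (positive⇒witness X∈ v))

    ¬acyclic⇒witness : ¬ Acyclic k N A → Σ (SignedSet n) (CyclicWitness k N A)
    ¬acyclic⇒witness h = let (X , X∈ , v) = ¬acyclic⇒positive h in positive⇒witness X∈ v

module _ (M : OrientedMatroid n) where

  circuit-inhabited : ∀ {X} → X ∈ˡ circuits M → Inhabited (supp X)
  circuit-inhabited {X} X∈ with Void⊎Inhabited (supp X)
  ... | inj₁ v   = ⊥-elim (C0 M X X∈ (Void⇒≡⊥ v))
  ... | inj₂ inh = inh

  -- a circuit inside N would contain the broken circuit obtained by removing its maximum
  NBC⇒Independent : ∀ {N} → NBC M N → Independent M N
  NBC⇒Independent {N} nbc X X∈ with Void⊎Inhabited (supp X ─ N)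
  ... | inj₂ inh = inh
  ... | inj₁ v =
    let (e , Xe , max) = maximum (supp X) (circuit-inhabited X∈) in
    ⊥-elim (nbc X e X∈ (!⇒∈ Xe) (λ f f∈ → max f (∈⇒! f∈))
              (⊑⇒⊆ _ _ λ i h → in-N (proj₁ (─-true (supp X) ⁅ e ⁆ i h)) (v i)))
    where
    in-N : ∀ {i} → supp X ! i ≡ true → (supp X ─ N) ! i ≡ false → N ! i ≡ true
    in-N {i} Xi h with N ! i in Ni
    ... | true  = refl
    ... | false = ⊥-elim (true≢false (─-intro (supp X) N i Xi Ni) h)

  NBC-anti : ∀ {N N′} → NBC M N → N′ ⊑ N → NBC M N′
  NBC-anti {N} {N′} nbc N′⊑N X e X∈ e∈ max sub =
    nbc X e X∈ e∈ max (⊑⇒⊆ _ _ λ i h → N′⊑N i (⊆⇒⊑ _ N′ sub i h))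

  Loopless⇒NBC-⊥ : Loopless M → NBC M ⊥
  Loopless⇒NBC-⊥ loopless X e X∈ e∈ _ sub = loopless X e X∈ (!-ext at)
    where
    at : ∀ i → supp X ! i ≡ ⁅ e ⁆ ! i
    at i with i ≟ e
    ... | yes refl = trans (∈⇒! e∈) (sym (⁅⁆-≡ {e = e}))
    ... | no i≢e with supp X ! i in Xi
    ...   | false = sym (⁅⁆-≢ i≢e)
    ...   | true  = ⊥-elim (true≢false (⊆⇒⊑ _ ⊥ sub i (─-intro (supp X) ⁅ e ⁆ i Xi (⁅⁆-≢ i≢e))) (!-⊥ i))

!-Eₖ : ∀ k (i : Fin n) → Eₖ k ! i ≡ (toℕ i <ᵇ k)
!-Eₖ k = lookup∘tabulate _

<⇒Eₖ : ∀ {k} {i : Fin n} → toℕ i < k → Eₖ k ! i ≡ true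
<⇒Eₖ {k = k} {i} lt = trans (!-Eₖ k i) (Equivalence.to T-≡ (<⇒<ᵇ lt))

Eₖ⇒< : ∀ {k} {i : Fin n} → Eₖ k ! i ≡ true → toℕ i < k
Eₖ⇒< {k = k} {i} h = <ᵇ⇒< (toℕ i) k (Equivalence.from T-≡ (trans (sym (!-Eₖ k i)) h))

≥⇒∉Eₖ : ∀ {k} {i : Fin n} → k ≤ toℕ i → Eₖ k ! i ≡ false
≥⇒∉Eₖ {k = k} {i} ge with Eₖ k ! i in h
... | false = refl
... | true  = ⊥-elim (<⇒≱ (Eₖ⇒< {i = i} h) ge)

Eₖ-mono : ∀ k → Eₖ {n} k ⊑ Eₖ (suc k)
Eₖ-mono k i h = <⇒Eₖ {i = i} (m<n⇒m<1+n (Eₖ⇒< {i = i} h))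

module _ (e : Fin n) where

  e∉Eₖ : Eₖ (toℕ e) ! e ≡ false
  e∉Eₖ = ≥⇒∉Eₖ {i = e} ≤-refl

  e∈Eₖ₊₁ : Eₖ (suc (toℕ e)) ! e ≡ true
  e∈Eₖ₊₁ = <⇒Eₖ {i = e} ≤-refl

  Eₖ₊₁-≢ : ∀ {i} → i ≢ e → Eₖ (suc (toℕ e)) ! i ≡ Eₖ (toℕ e) ! i
  Eₖ₊₁-≢ {i} i≢e with Eₖ (toℕ e) ! i in h
  ... | true  = Eₖ-mono (toℕ e) i h
  ... | false = ≥⇒∉Eₖ {i = i}
    (≤∧≢⇒< (≮⇒≥ (λ lt → true≢false (<⇒Eₖ {i = i} lt) h)) (i≢e ∘ toℕ-injective ∘ sym))

-- One step of ψ

module Step (M : OrientedMatroid n) (e : Fin n) where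

  private
    k = toℕ e
    Δ = Eₖ {n} k
    Δ⁺ = Eₖ {n} (suc k)
    C = circuits M

  e∉N : ∀ {N} → N ⊑ Δ → N ! e ≡ false
  e∉N {N} N⊑Δ with N ! e in h
  ... | false = refl
  ... | true  = ⊥-elim (true≢false (N⊑Δ e h) (e∉Eₖ e))

  Δ─-≢ : ∀ N {i} → i ≢ e → (Δ⁺ ─ N) ! i ≡ (Δ ─ N) ! i
  Δ─-≢ N {i} i≢e rewrite !-─ Δ⁺ N i | !-─ Δ N i | Eₖ₊₁-≢ e i≢e = refl

  avoid-e⇒Disjoint : ∀ {N Y} → supp Y ! e ≡ false → Disjoint (supp Y) (Δ ─ N) → Disjoint (supp Y) (Δ⁺ ─ N)
  avoid-e⇒Disjoint {N} Ye d i y with i ≟ e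
  ... | yes refl = ⊥-elim (true≢false y Ye)
  ... | no i≢e   = trans (Δ─-≢ N i≢e) (d i y)

  Disjoint⇒avoid-e : ∀ {N Y} → N ⊑ Δ → Disjoint (supp Y) (Δ⁺ ─ N) → supp Y ! e ≡ false
  Disjoint⇒avoid-e {N} {Y} N⊑Δ d =
    Disjoint-sym {p = supp Y} {Δ⁺ ─ N} d e (─-intro Δ⁺ N e (e∈Eₖ₊₁ e) (e∉N {N} N⊑Δ))

  module _ {A : Subset n} {Y : SignedSet n} where

    flip-e : Y ∈ˡ C → A ! e ≡ false → neg (reorientSet A Y) ! e ≡ true →
             neg (reorientSet (A ∪ ⁅ e ⁆) Y) ! e ≡ false
    flip-e Y∈ Ae h = trans (neg-reorient-∈ (A ∪ ⁅ e ⁆) {Y} (∪⁅⁆-≡ A))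
      (Disjoint-sym {p = pos Y} {neg Y} (circuit-signs-disjoint M Y∈) e
        (trans (sym (neg-reorient-∉ A {Y} Ae)) h))

    flip-≢ : ∀ {i} → i ≢ e → neg (reorientSet (A ∪ ⁅ e ⁆) Y) ! i ≡ neg (reorientSet A Y) ! i
    flip-≢ i≢e = neg-reorient-cong (A ∪ ⁅ e ⁆) Y _ A (λ _ → ∪⁅⁆-≢ A i≢e)

  -- e is the largest element of N ∪ {e}, so such a circuit would contain a broken circuit inside N
  ¬circuit⊆N∪e : ∀ {N Y} → NBC M N → N ⊑ Δ → Y ∈ˡ C → supp Y ! e ≡ true →
                 ¬ (∀ i → supp Y ! i ≡ true → N ! i ≡ false → i ≡ e)
  ¬circuit⊆N∪e {N} {Y} nbc N⊑Δ Y∈ Ye off-N = nbc Y e Y∈ (!⇒∈ Ye) below (⊑⇒⊆ _ N rest⊑N)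
    where
    below : ∀ f → f ∈ supp Y → toℕ f ≤ toℕ e
    below f f∈ with N ! f in Nf
    ... | true  = <⇒≤ (Eₖ⇒< {k = k} {i = f} (N⊑Δ f Nf))
    ... | false with off-N f (∈⇒! f∈) Nf
    ...   | refl = ≤-refl
    rest⊑N : supp Y ─ ⁅ e ⁆ ⊑ N
    rest⊑N i h with N ! i in Ni
    ... | true  = refl
    ... | false with off-N i (proj₁ (─-true (supp Y) ⁅ e ⁆ i h)) Ni
    ...   | refl = ⊥-elim (true≢false h (─⁅⁆-≡ (supp Y)))

  module _ {N A : Subset n} (nbc : NBC M N) (N⊑Δ : N ⊑ Δ) where

    private
      indep = NBC⇒Independent M nbc

    acyclic-step : ∀ {A′} → (∀ {i} → i ≢ e → A′ ! i ≡ A ! i) →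
                   Acyclic M k N A → Acyclic M (suc k) N A′
    acyclic-step {A′} A′≈A ac = ¬witness⇒acyclic M {suc k} {N} {A′} λ {Y} (Y∈ , dY , pY) →
      let Ye = Disjoint⇒avoid-e {Y = Y} N⊑Δ dY in
      acyclic⇒¬witness M {k} {N} {A} indep ac
        ( Y∈
        , Disjoint-anti {x = supp Y} {Δ ─ N} {Δ⁺ ─ N} dY (─-mono {p = Δ} {Δ⁺} N (Eₖ-mono k))
        , PositiveOutside-cong {S = N} {A′} {Y} (λ i y _ → A′≈A λ { refl → true≢false y Ye }) pY )

    acyclic-add : A ! e ≡ false → Acyclic M k N A → Acyclic M k N (A ∪ ⁅ e ⁆) →
                  Acyclic M (suc k) (N ∪ ⁅ e ⁆) A
    acyclic-add Ae ac ac⁺ = ¬witness⇒acyclic M {suc k} {N ∪ ⁅ e ⁆} {A} refute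
      where
      inside : Δ ─ N ⊑ Δ⁺ ─ (N ∪ ⁅ e ⁆)
      inside i h with ─-true Δ N i h
      ... | Δi , Ni = ─-intro Δ⁺ (N ∪ ⁅ e ⁆) i (Eₖ-mono k i Δi)
                        (trans (∪⁅⁆-≢ N λ { refl → true≢false Δi (e∉Eₖ e) }) Ni)
      refute : ∀ {Y} → ¬ CyclicWitness M (suc k) (N ∪ ⁅ e ⁆) A Y
      refute {Y} (Y∈ , dY , pY) with neg (reorientSet A Y) ! e in ne
      ... | false = acyclic⇒¬witness M {k} {N} {A} indep ac (Y∈ , dY′ , λ i Ni → at i Ni (i ≟ e))
        where
        dY′ = Disjoint-anti {x = supp Y} {Δ ─ N} {Δ⁺ ─ (N ∪ ⁅ e ⁆)} dY inside
        at : ∀ i → N ! i ≡ false → Dec (i ≡ e) → neg (reorientSet A Y) ! i ≡ false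
        at i Ni (yes refl) = ne
        at i Ni (no i≢e)   = pY i (trans (∪⁅⁆-≢ N i≢e) Ni)
      ... | true = acyclic⇒¬witness M {k} {N} {A ∪ ⁅ e ⁆} indep ac⁺ (Y∈ , dY′ , λ i Ni → at i Ni (i ≟ e))
        where
        dY′ = Disjoint-anti {x = supp Y} {Δ ─ N} {Δ⁺ ─ (N ∪ ⁅ e ⁆)} dY inside
        at : ∀ i → N ! i ≡ false → Dec (i ≡ e) → neg (reorientSet (A ∪ ⁅ e ⁆) Y) ! i ≡ false
        at i Ni (yes refl) = flip-e {A} {Y} Y∈ Ae ne
        at i Ni (no i≢e)   = trans (flip-≢ {A} {Y} i≢e) (pY i (trans (∪⁅⁆-≢ N i≢e) Ni))

    two-point⁺ : A ! e ≡ false → Acyclic M k N A → Acyclic M k N (A ∪ ⁅ e ⁆) →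
      ∀ {Z v} → Z ∈ˡ C → Disjoint (supp Z) (Δ ─ N) →
      (∀ i → supp Z ! i ≡ true → N ! i ≡ false → i ≡ e ⊎ i ≡ v) →
      neg (reorientSet A Z) ! v ≡ false → Empty.⊥
    two-point⁺ Ae ac ac⁺ {Z} {v} Z∈ dZ off nv with neg (reorientSet A Z) ! e in ne
    ... | false = acyclic⇒¬witness M {k} {N} {A} indep ac
                    (Z∈ , dZ , PositiveOutside-intro {S = N} {A} {Z} λ i z Ni → at i (off i z Ni))
      where
      at : ∀ i → i ≡ e ⊎ i ≡ v → neg (reorientSet A Z) ! i ≡ false
      at i (inj₁ refl) = ne
      at i (inj₂ refl) = nv
    ... | true  = acyclic⇒¬witness M {k} {N} {A ∪ ⁅ e ⁆} indep ac⁺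
                    (Z∈ , dZ , PositiveOutside-intro {S = N} {A ∪ ⁅ e ⁆} {Z} λ i z Ni → at i (off i z Ni))
      where
      v≢e : v ≢ e
      v≢e refl = true≢false ne nv
      at : ∀ i → i ≡ e ⊎ i ≡ v → neg (reorientSet (A ∪ ⁅ e ⁆) Z) ! i ≡ false
      at i (inj₁ refl) = flip-e {A} {Z} Z∈ Ae ne
      at i (inj₂ refl) = trans (flip-≢ {A} {Z} v≢e) nv

    -- replacing X by -X makes the sign at v positive; two-point⁺ then fixes the sign at e
    two-point : A ! e ≡ false → Acyclic M k N A → Acyclic M k N (A ∪ ⁅ e ⁆) →
      ∀ {X v} → X ∈ˡ C → Disjoint (supp X) (Δ ─ N) →
      (∀ i → supp X ! i ≡ true → N ! i ≡ false → i ≡ e ⊎ i ≡ v) → Empty.⊥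
    two-point Ae ac ac⁺ {X} {v} X∈ dX off-N with neg (reorientSet A X) ! v in nv
    ... | false = two-point⁺ Ae ac ac⁺ X∈ dX off-N nv
    ... | true  = two-point⁺ Ae ac ac⁺ (C1 M X X∈)
                    (subst (λ s → Disjoint s (Δ ─ N)) (sym (supp-opp X)) dX)
                    (subst (λ s → ∀ i → s ! i ≡ true → N ! i ≡ false → i ≡ e ⊎ i ≡ v) (sym (supp-opp X)) off-N)
                    (Disjoint-sym {p = pos (reorientSet A X)} {neg (reorientSet A X)}
                      (reorient-signs-disjoint A X (circuit-signs-disjoint M X∈)) v nv)

    NBC-add : A ! e ≡ false → Acyclic M k N A → Acyclic M k N (A ∪ ⁅ e ⁆) → NBC M (N ∪ ⁅ e ⁆)
    NBC-add Ae ac ac⁺ X f X∈ f∈ max sub with supp X ! e in Xe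
    ... | false = nbc X f X∈ f∈ max (⊑⇒⊆ _ N rest⊑N)
      where
      rest⊑N : supp X ─ ⁅ f ⁆ ⊑ N
      rest⊑N i h with ∪-true N ⁅ e ⁆ i (⊆⇒⊑ _ (N ∪ ⁅ e ⁆) sub i h)
      ... | inj₁ Ni = Ni
      ... | inj₂ ei with ⁅⁆-true {e = e} {j = i} ei
      ...   | refl = ⊥-elim (true≢false (proj₁ (─-true (supp X) ⁅ f ⁆ e h)) Xe)
    ... | true = two-point Ae ac ac⁺ X∈ dX off-N
      where
      off-N : ∀ i → supp X ! i ≡ true → N ! i ≡ false → i ≡ e ⊎ i ≡ f
      off-N i Xi Ni with i ≟ f
      ... | yes i≡f = inj₂ i≡f
      ... | no i≢f
        with ∪-true N ⁅ e ⁆ i (⊆⇒⊑ _ (N ∪ ⁅ e ⁆) sub i (─-intro (supp X) ⁅ f ⁆ i Xi (⁅⁆-≢ i≢f)))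
      ...   | inj₁ Ni′ = ⊥-elim (true≢false Ni′ Ni)
      ...   | inj₂ ei  = inj₁ (⁅⁆-true {e = e} ei)
      dX : Disjoint (supp X) (Δ ─ N)
      dX i Xi with N ! i in Ni
      ... | true  = ─-falseʳ Δ N i Ni
      ... | false with off-N i Xi Ni
      ...   | inj₁ refl = ─-falseˡ Δ N i (e∉Eₖ e)
      ...   | inj₂ refl = ─-falseˡ Δ N i (≥⇒∉Eₖ {i = f} (max e (!⇒∈ Xe)))

    -- Y₁ and Y₂ carry e with opposite signs after reorienting by A; eliminating e between them
    -- gives a witness that avoids e
    eliminate-e : A ! e ≡ false → ∀ {Y₁ Y₂} →
      CyclicWitness M k N A Y₁ → CyclicWitness M k N (A ∪ ⁅ e ⁆) Y₂ →
      supp Y₁ ! e ≡ true → supp Y₂ ! e ≡ true → Σ (SignedSet n) (CyclicWitness M (suc k) N A)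
    eliminate-e Ae {Y₁} {Y₂} (Y₁∈ , d₁ , p₁) (Y₂∈ , d₂ , p₂) Y₁e Y₂e =
      lift (proj₁ (proj₂ elim)) (proj₁ (proj₂ (proj₂ elim))) (proj₂ (proj₂ (proj₂ elim)))
      where
      σ₁ = reorientSet A Y₁
      σ₂ = reorientSet A Y₂
      e∉N′ = e∉N {N} N⊑Δ

      supp-σ : ∀ Y i → supp (reorientSet A Y) ! i ≡ supp Y ! i
      supp-σ Y i = cong (_! i) (supp-reorient A Y)

      p₂′ : ∀ i → N ! i ≡ false → i ≢ e → neg σ₂ ! i ≡ false
      p₂′ i Ni i≢e = trans (sym (flip-≢ {A} {Y₂} i≢e)) (p₂ i Ni)

      e⁺ : pos σ₁ ! e ≡ true
      e⁺ = supp⇒pos σ₁ e (trans (supp-σ Y₁ e) Y₁e) (p₁ e e∉N′)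

      e⁻ : neg σ₂ ! e ≡ true
      e⁻ = trans (neg-reorient-∉ A {Y₂} Ae)
             (supp⇒neg Y₂ e Y₂e (trans (sym (neg-reorient-∈ (A ∪ ⁅ e ⁆) {Y₂} (∪⁅⁆-≡ A))) (p₂ e e∉N′)))

      σ₁≢-σ₂ : σ₁ ≢ opp σ₂
      σ₁≢-σ₂ eq = ¬circuit⊆N∪e nbc N⊑Δ Y₁∈ Y₁e λ i y Ni → at i y Ni (i ≟ e)
        where
        at : ∀ i → supp Y₁ ! i ≡ true → N ! i ≡ false → Dec (i ≡ e) → i ≡ e
        at i y Ni (yes i≡e) = i≡e
        at i y Ni (no i≢e)  = ⊥-elim (true≢false
          (trans (sym (cong (λ X → pos X ! i) eq)) (supp⇒pos σ₁ i (trans (supp-σ Y₁ i) y) (p₁ i Ni)))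
          (p₂′ i Ni i≢e))

      elim = C3 (reorientation A M) σ₁ σ₂ e (∈-map⁺ (reorientSet A) Y₁∈) (∈-map⁺ (reorientSet A) Y₂∈)
                σ₁≢-σ₂ (!⇒∈ e⁺) (!⇒∈ e⁻)

      lift : ∀ {Z′} → Z′ ∈ˡ reorient A C → pos Z′ ⊆ (pos σ₁ ∪ pos σ₂) ─ ⁅ e ⁆ →
             neg Z′ ⊆ (neg σ₁ ∪ neg σ₂) ─ ⁅ e ⁆ → Σ (SignedSet n) (CyclicWitness M (suc k) N A)
      lift Z′∈ hp hn with ∈-map⁻ (reorientSet A) Z′∈
      ... | Z , Z∈ , refl = Z , Z∈ , dZ , pZ
        where
        dZ : Disjoint (supp Z) (Δ⁺ ─ N)
        dZ i z with elimination-supp hp hn i (trans (supp-σ Z i) z)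
        ... | inj₁ y , i≢e = trans (Δ─-≢ N i≢e) (d₁ i (trans (sym (supp-σ Y₁ i)) y))
        ... | inj₂ y , i≢e = trans (Δ─-≢ N i≢e) (d₂ i (trans (sym (supp-σ Y₂ i)) y))
        pZ : PositiveOutside N (reorientSet A Z)
        pZ i Ni with neg (reorientSet A Z) ! i in z
        ... | false = refl
        ... | true with ─-true (neg σ₁ ∪ neg σ₂) ⁅ e ⁆ i (⊆⇒⊑ _ _ hn i z)
        ...   | u , ei with ∪-true (neg σ₁) (neg σ₂) i u
        ...     | inj₁ n₁ = ⊥-elim (true≢false n₁ (p₁ i Ni))
        ...     | inj₂ n₂ = ⊥-elim (true≢false n₂ (p₂′ i Ni λ { refl → true≢false (⁅⁆-≡ {e = e}) ei }))

    acyclic-keep : A ! e ≡ false → Acyclic M (suc k) N A → ¬ Acyclic M k N (A ∪ ⁅ e ⁆) → Acyclic M k N A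
    acyclic-keep Ae ac ¬ac⁺ = ¬witness⇒acyclic M {k} {N} {A} λ w₁ →
      refute w₁ (proj₂ (¬acyclic⇒witness M {k} {N} {A ∪ ⁅ e ⁆} ¬ac⁺))
      where
      ¬witness⁺ = acyclic⇒¬witness M {suc k} {N} {A} indep ac
      refute : ∀ {Y₁ Y₂} → CyclicWitness M k N A Y₁ → CyclicWitness M k N (A ∪ ⁅ e ⁆) Y₂ → Empty.⊥
      refute {Y₁} {Y₂} w₁ w₂ with supp Y₁ ! e in Y₁e | supp Y₂ ! e in Y₂e
      ... | false | _ = let (Y₁∈ , d₁ , p₁) = w₁ in
        ¬witness⁺ (Y₁∈ , avoid-e⇒Disjoint {N} {Y₁} Y₁e d₁ , p₁)
      ... | true | false = let (Y₂∈ , d₂ , p₂) = w₂ in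
        ¬witness⁺ (Y₂∈ , avoid-e⇒Disjoint {N} {Y₂} Y₂e d₂
                  , PositiveOutside-cong {S = N} {A ∪ ⁅ e ⁆} {Y₂}
                      (λ i y _ → ∪⁅⁆-≢ A λ { refl → true≢false y Y₂e }) p₂)
      ... | true | true = ¬witness⁺ (proj₂ (eliminate-e Ae w₁ w₂ Y₁e Y₂e))

  acyclic-contract : ∀ {N A R} → NBC M N → N ! e ≡ true → (∀ {i} → i ≢ e → R ! i ≡ A ! i) →
                     Acyclic M (suc k) N A → Acyclic M k (N ─ ⁅ e ⁆) R
  acyclic-contract {N} {A} {R} nbc Ne R≈A ac = ¬witness⇒acyclic M {k} {N ─ ⁅ e ⁆} {R} λ {Y} (Y∈ , dY , pY) →
    acyclic⇒¬witness M {suc k} {N} {A} (NBC⇒Independent M nbc) ac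
      ( Y∈
      , Disjoint-anti {x = supp Y} {Δ⁺ ─ N} {Δ ─ (N ─ ⁅ e ⁆)} dY inside
      , λ i Ni → trans (sym (neg-reorient-cong R Y i A (λ _ → R≈A (off-N⇒≢e Ni))))
                       (pY i (─-falseˡ N ⁅ e ⁆ i Ni)) )
    where
    off-N⇒≢e : ∀ {i} → N ! i ≡ false → i ≢ e
    off-N⇒≢e Ni refl = true≢false Ne Ni
    inside : Δ⁺ ─ N ⊑ Δ ─ (N ─ ⁅ e ⁆)
    inside i h with ─-true Δ⁺ N i h
    ... | Δ⁺i , Ni =
      ─-intro Δ (N ─ ⁅ e ⁆) i (trans (sym (Eₖ₊₁-≢ e (off-N⇒≢e Ni))) Δ⁺i) (─-falseˡ N ⁅ e ⁆ i Ni)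

module _ {X Y : Set} {P : X → Set} {Q : Y → Set} where

  BijOn-inverse : ∀ {f : X → Y} (g : Y → X) → (∀ x → P x → Q (f x)) → (∀ y → Q y → P (g y)) →
                  (∀ x → P x → g (f x) ≡ x) → (∀ y → Q y → f (g y) ≡ y) → BijOn P Q f
  BijOn-inverse g maps-to maps-from left right =
      maps-to
    , (λ x x′ px px′ eq → trans (sym (left x px)) (trans (cong g eq) (left x′ px′)))
    , (λ y qy → g y , maps-from y qy , right y qy)

  BijOn-∘ : ∀ {Z : Set} {R : Z → Set} {f : X → Y} {g : Y → Z} →
            BijOn P Q f → BijOn Q R g → BijOn P R (g ∘ f)
  BijOn-∘ {g = g} (f-to , f-inj , f-onto) (g-to , g-inj , g-onto) =
      (λ x px → g-to _ (f-to x px))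
    , (λ x x′ px px′ eq → f-inj x x′ px px′ (g-inj _ _ (f-to x px) (f-to x′ px′) eq))
    , (λ z rz → let (y , qy , gy) = g-onto z rz ; (x , px , fx) = f-onto y qy in
                x , px , trans (cong g fx) gy)

BijOn-id : ∀ {X : Set} {P : X → Set} → BijOn P P (λ x → x)
BijOn-id = (λ _ p → p) , (λ _ _ _ _ eq → eq) , (λ y q → y , q , refl)

module _ (M : OrientedMatroid n) (k : ℕ) (N A : Subset n) where

  𝒩-intro : N ⊑ Eₖ k → Disjoint A (Eₖ k) → NBC M N → Acyclic M k N A → 𝒩 M k (N , A)
  𝒩-intro N⊑ dA nbc ac = ⊑⇒⊆ N (Eₖ k) N⊑ , Disjoint⇒∩≡⊥ A (Eₖ k) dA , nbc , ac

  𝒩-elim : 𝒩 M k (N , A) → N ⊑ Eₖ k × Disjoint A (Eₖ k) × NBC M N × Acyclic M k N A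
  𝒩-elim (N⊆ , A∩ , nbc , ac) = ⊆⇒⊑ N (Eₖ k) N⊆ , ∩≡⊥⇒Disjoint A (Eₖ k) A∩ , nbc , ac

module StepBijection (M : OrientedMatroid n) (e : Fin n) where

  open Step M e

  private
    k = toℕ e
    Δ = Eₖ {n} k
    Δ⁺ = Eₖ {n} (suc k)

    if-true : ∀ {X : Set} {b} {x y : X} → b ≡ true → (if b then x else y) ≡ x
    if-true refl = refl

    if-false : ∀ {X : Set} {b} {x y : X} → b ≡ false → (if b then x else y) ≡ y
    if-false refl = refl

    ¬T⇒≡false : ∀ {b} → ¬ T b → b ≡ false
    ¬T⇒≡false {false} _ = refl
    ¬T⇒≡false {true}  h = ⊥-elim (h _)

  Addable : Subset n → Subset n → Set
  Addable N A = Acyclic M k N (A ∪ ⁅ e ⁆)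

  -- the three cases in the definition of ψₖ (with b = A ! e) and of its inverse (with b = N ! e)
  data Case (b : Bool) (N A : Subset n) : Set where
    present   : b ≡ true → Case b N A
    addable   : b ≡ false → Addable N A → Case b N A
    unaddable : b ≡ false → ¬ Addable N A → Case b N A

  case : ∀ b N A → Case b N A
  case true  N A = present refl
  case false N A with T? (acyclic (minorCircuits M k N (A ∪ ⁅ e ⁆)))
  ... | yes ac = addable refl ac
  ... | no ¬ac = unaddable refl ¬ac

  reorient-e : ∀ N A → A ! e ≡ false →
    reorient ⁅ e ⁆ (minorCircuits M k N A) ≡ minorCircuits M k N (A ∪ ⁅ e ⁆)
  reorient-e N A Ae = begin
    map (reorientSet ⁅ e ⁆) (map (reorientSet A) L)   ≡⟨ map-∘ L ⟨
    map (reorientSet ⁅ e ⁆ ∘ reorientSet A) L         ≡⟨ map-cong (λ X → reorientSet-∪ A ⁅ e ⁆ X e-fresh) L ⟩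
    map (reorientSet (A ∪ ⁅ e ⁆)) L                   ∎
    where
    open ≡-Reasoning
    L = contract N (delete (Δ ─ N) (circuits M))
    e-fresh : Disjoint ⁅ e ⁆ A
    e-fresh i h with ⁅⁆-true {e = e} {j = i} h
    ... | refl = Ae

  module _ {N A : Subset n} where

    ψₖ-present : A ! e ≡ true → ψₖ M e (N , A) ≡ (N , A ─ ⁅ e ⁆)
    ψₖ-present Ae = if-true (trans (∈ᵇ-! e A) Ae)

    ψₖ-addable : A ! e ≡ false → Addable N A → ψₖ M e (N , A) ≡ (N ∪ ⁅ e ⁆ , A)
    ψₖ-addable Ae ac = trans (if-false (trans (∈ᵇ-! e A) Ae))
      (if-true (trans (cong acyclic (reorient-e N A Ae)) (Equivalence.to T-≡ ac)))

    ψₖ-unaddable : A ! e ≡ false → ¬ Addable N A → ψₖ M e (N , A) ≡ (N , A)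
    ψₖ-unaddable Ae ¬ac = trans (if-false (trans (∈ᵇ-! e A) Ae))
      (if-false (trans (cong acyclic (reorient-e N A Ae)) (¬T⇒≡false ¬ac)))

  ψₖ⁻¹ : Pair n → Pair n
  ψₖ⁻¹ (N , A) = if N ! e then (N ─ ⁅ e ⁆ , A)
                 else (if acyclic (minorCircuits M k N (A ∪ ⁅ e ⁆)) then (N , A ∪ ⁅ e ⁆) else (N , A))

  module _ {N A : Subset n} where

    ψₖ⁻¹-present : N ! e ≡ true → ψₖ⁻¹ (N , A) ≡ (N ─ ⁅ e ⁆ , A)
    ψₖ⁻¹-present = if-true

    ψₖ⁻¹-addable : N ! e ≡ false → Addable N A → ψₖ⁻¹ (N , A) ≡ (N , A ∪ ⁅ e ⁆)
    ψₖ⁻¹-addable Ne ac = trans (if-false Ne) (if-true (Equivalence.to T-≡ ac))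

    ψₖ⁻¹-unaddable : N ! e ≡ false → ¬ Addable N A → ψₖ⁻¹ (N , A) ≡ (N , A)
    ψₖ⁻¹-unaddable Ne ¬ac = trans (if-false Ne) (if-false (¬T⇒≡false ¬ac))

  Disjoint-Δ⁺ : ∀ A → Disjoint A Δ → A ! e ≡ false → Disjoint A Δ⁺
  Disjoint-Δ⁺ A dA Ae i Ai with i ≟ e
  ... | yes refl = ⊥-elim (true≢false Ai Ae)
  ... | no i≢e   = trans (Eₖ₊₁-≢ e i≢e) (dA i Ai)

  ⊑Δ⁺-without-e : ∀ N → N ⊑ Δ⁺ → ∀ i → N ! i ≡ true → i ≢ e → Δ ! i ≡ true
  ⊑Δ⁺-without-e N N⊑ i Ni i≢e = trans (sym (Eₖ₊₁-≢ e i≢e)) (N⊑ i Ni)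

  ⊑Δ⁺-e∉ : ∀ N → N ⊑ Δ⁺ → N ! e ≡ false → N ⊑ Δ
  ⊑Δ⁺-e∉ N N⊑ Ne i Ni = ⊑Δ⁺-without-e N N⊑ i Ni λ { refl → true≢false Ni Ne }

  e∉-Δ⁺-disjoint : ∀ A → Disjoint A Δ⁺ → A ! e ≡ false
  e∉-Δ⁺-disjoint A dA = Disjoint-sym {p = A} {Δ⁺} dA e (e∈Eₖ₊₁ e)

  ψₖ-maps-to : ∀ x → 𝒩 M k x → 𝒩 M (suc k) (ψₖ M e x)
  ψₖ-maps-to (N , A) x∈ = by-case (case (A ! e) N A)
    where
    N⊑Δ = proj₁ (𝒩-elim M k N A x∈)
    dA  = proj₁ (proj₂ (𝒩-elim M k N A x∈))
    nbc = proj₁ (proj₂ (proj₂ (𝒩-elim M k N A x∈)))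
    ac  = proj₂ (proj₂ (proj₂ (𝒩-elim M k N A x∈)))
    N⊑Δ⁺ : N ⊑ Δ⁺
    N⊑Δ⁺ i Ni = Eₖ-mono k i (N⊑Δ i Ni)

    by-case : Case (A ! e) N A → 𝒩 M (suc k) (ψₖ M e (N , A))
    by-case (present Ae) =
      subst (𝒩 M (suc k)) (sym (ψₖ-present Ae))
        (𝒩-intro M (suc k) N (A ─ ⁅ e ⁆) N⊑Δ⁺ dA′ nbc (acyclic-step {N} {A} nbc N⊑Δ (─⁅⁆-≢ A) ac))
      where
      dA′ : Disjoint (A ─ ⁅ e ⁆) Δ⁺
      dA′ i h with i ≟ e
      ... | yes refl = ⊥-elim (true≢false h (─⁅⁆-≡ A))
      ... | no i≢e   = trans (Eₖ₊₁-≢ e i≢e) (dA i (proj₁ (─-true A ⁅ e ⁆ i h)))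
    by-case (addable Ae ac⁺) =
      subst (𝒩 M (suc k)) (sym (ψₖ-addable Ae ac⁺))
        (𝒩-intro M (suc k) (N ∪ ⁅ e ⁆) A N∪e⊑Δ⁺ (Disjoint-Δ⁺ A dA Ae)
          (NBC-add {N} {A} nbc N⊑Δ Ae ac ac⁺) (acyclic-add {N} {A} nbc N⊑Δ Ae ac ac⁺))
      where
      N∪e⊑Δ⁺ : N ∪ ⁅ e ⁆ ⊑ Δ⁺
      N∪e⊑Δ⁺ i h with ∪-true N ⁅ e ⁆ i h
      ... | inj₁ Ni = N⊑Δ⁺ i Ni
      ... | inj₂ ei with ⁅⁆-true {e = e} {j = i} ei
      ...   | refl = e∈Eₖ₊₁ e
    by-case (unaddable Ae ¬ac⁺) =
      subst (𝒩 M (suc k)) (sym (ψₖ-unaddable Ae ¬ac⁺))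
        (𝒩-intro M (suc k) N A N⊑Δ⁺ (Disjoint-Δ⁺ A dA Ae) nbc (acyclic-step {N} {A} nbc N⊑Δ (λ _ → refl) ac))

  ψₖ⁻¹-maps-to : ∀ y → 𝒩 M (suc k) y → 𝒩 M k (ψₖ⁻¹ y)
  ψₖ⁻¹-maps-to (N , A) y∈ = by-case (case (N ! e) N A)
    where
    N⊑Δ⁺ = proj₁ (𝒩-elim M (suc k) N A y∈)
    dA   = proj₁ (proj₂ (𝒩-elim M (suc k) N A y∈))
    nbc  = proj₁ (proj₂ (proj₂ (𝒩-elim M (suc k) N A y∈)))
    ac   = proj₂ (proj₂ (proj₂ (𝒩-elim M (suc k) N A y∈)))
    dAΔ  = Disjoint-anti {x = A} {Δ} {Δ⁺} dA (Eₖ-mono k)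

    by-case : Case (N ! e) N A → 𝒩 M k (ψₖ⁻¹ (N , A))
    by-case (present Ne) =
      subst (𝒩 M k) (sym (ψₖ⁻¹-present Ne))
        (𝒩-intro M k (N ─ ⁅ e ⁆) A N─e⊑Δ dAΔ
          (NBC-anti M {N} {N ─ ⁅ e ⁆} nbc λ i h → proj₁ (─-true N ⁅ e ⁆ i h))
          (acyclic-contract {N} {A} {A} nbc Ne (λ _ → refl) ac))
      where
      N─e⊑Δ : N ─ ⁅ e ⁆ ⊑ Δ
      N─e⊑Δ i h with ─-true N ⁅ e ⁆ i h
      ... | Ni , i∉e = ⊑Δ⁺-without-e N N⊑Δ⁺ i Ni λ { refl → true≢false (⁅⁆-≡ {e = e}) i∉e }
    by-case (addable Ne ac⁺) =
      subst (𝒩 M k) (sym (ψₖ⁻¹-addable Ne ac⁺))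
        (𝒩-intro M k N (A ∪ ⁅ e ⁆) (⊑Δ⁺-e∉ N N⊑Δ⁺ Ne) A∪e-disjoint nbc ac⁺)
      where
      A∪e-disjoint : Disjoint (A ∪ ⁅ e ⁆) Δ
      A∪e-disjoint i h with i ≟ e
      ... | yes refl = e∉Eₖ e
      ... | no i≢e   = dAΔ i (trans (sym (∪⁅⁆-≢ A i≢e)) h)
    by-case (unaddable Ne ¬ac⁺) =
      subst (𝒩 M k) (sym (ψₖ⁻¹-unaddable Ne ¬ac⁺))
        (𝒩-intro M k N A (⊑Δ⁺-e∉ N N⊑Δ⁺ Ne) dAΔ nbc
          (acyclic-keep {N} {A} nbc (⊑Δ⁺-e∉ N N⊑Δ⁺ Ne) (e∉-Δ⁺-disjoint A dA) ac ¬ac⁺))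

  ψₖ⁻¹∘ψₖ : ∀ x → 𝒩 M k x → ψₖ⁻¹ (ψₖ M e x) ≡ x
  ψₖ⁻¹∘ψₖ (N , A) (N⊆ , _ , _ , ac) = by-case (case (A ! e) N A)
    where
    open ≡-Reasoning
    e∉N′ = e∉N {N} (⊆⇒⊑ N Δ N⊆)
    by-case : Case (A ! e) N A → ψₖ⁻¹ (ψₖ M e (N , A)) ≡ (N , A)
    by-case (present Ae) = begin
      ψₖ⁻¹ (ψₖ M e (N , A))         ≡⟨ cong ψₖ⁻¹ (ψₖ-present Ae) ⟩
      ψₖ⁻¹ (N , A ─ ⁅ e ⁆)          ≡⟨ ψₖ⁻¹-addable e∉N′ (subst (Acyclic M k N) (sym (─⁅⁆∪⁅⁆ e A Ae)) ac) ⟩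
      (N , (A ─ ⁅ e ⁆) ∪ ⁅ e ⁆)     ≡⟨ cong (N ,_) (─⁅⁆∪⁅⁆ e A Ae) ⟩
      (N , A)                       ∎
    by-case (addable Ae ac⁺) = begin
      ψₖ⁻¹ (ψₖ M e (N , A))         ≡⟨ cong ψₖ⁻¹ (ψₖ-addable Ae ac⁺) ⟩
      ψₖ⁻¹ (N ∪ ⁅ e ⁆ , A)          ≡⟨ ψₖ⁻¹-present (∪⁅⁆-≡ N) ⟩
      ((N ∪ ⁅ e ⁆) ─ ⁅ e ⁆ , A)     ≡⟨ cong (_, A) (∪⁅⁆─⁅⁆ e N e∉N′) ⟩
      (N , A)                       ∎
    by-case (unaddable Ae ¬ac⁺) =
      trans (cong ψₖ⁻¹ (ψₖ-unaddable Ae ¬ac⁺)) (ψₖ⁻¹-unaddable e∉N′ ¬ac⁺)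

  ψₖ∘ψₖ⁻¹ : ∀ y → 𝒩 M (suc k) y → ψₖ M e (ψₖ⁻¹ y) ≡ y
  ψₖ∘ψₖ⁻¹ (N , A) (_ , A∩ , nbc , ac) = by-case (case (N ! e) N A)
    where
    open ≡-Reasoning
    Ae = e∉-Δ⁺-disjoint A (∩≡⊥⇒Disjoint A Δ⁺ A∩)
    by-case : Case (N ! e) N A → ψₖ M e (ψₖ⁻¹ (N , A)) ≡ (N , A)
    by-case (present Ne) = begin
      ψₖ M e (ψₖ⁻¹ (N , A))         ≡⟨ cong (ψₖ M e) (ψₖ⁻¹-present Ne) ⟩
      ψₖ M e (N ─ ⁅ e ⁆ , A)        ≡⟨ ψₖ-addable Ae (acyclic-contract {N} {A} {A ∪ ⁅ e ⁆} nbc Ne (∪⁅⁆-≢ A) ac) ⟩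
      ((N ─ ⁅ e ⁆) ∪ ⁅ e ⁆ , A)     ≡⟨ cong (_, A) (─⁅⁆∪⁅⁆ e N Ne) ⟩
      (N , A)                       ∎
    by-case (addable Ne ac⁺) = begin
      ψₖ M e (ψₖ⁻¹ (N , A))         ≡⟨ cong (ψₖ M e) (ψₖ⁻¹-addable Ne ac⁺) ⟩
      ψₖ M e (N , A ∪ ⁅ e ⁆)        ≡⟨ ψₖ-present (∪⁅⁆-≡ A) ⟩
      (N , (A ∪ ⁅ e ⁆) ─ ⁅ e ⁆)     ≡⟨ cong (N ,_) (∪⁅⁆─⁅⁆ e A Ae) ⟩
      (N , A)                       ∎
    by-case (unaddable Ne ¬ac⁺) =
      trans (cong (ψₖ M e) (ψₖ⁻¹-unaddable Ne ¬ac⁺)) (ψₖ-unaddable Ae ¬ac⁺)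

  ψₖ-bijective : BijOn (𝒩 M k) (𝒩 M (suc k)) (ψₖ M e)
  ψₖ-bijective = BijOn-inverse ψₖ⁻¹ ψₖ-maps-to ψₖ⁻¹-maps-to ψₖ⁻¹∘ψₖ ψₖ∘ψₖ⁻¹

-- The composite ψ and its end points

module _ (M : OrientedMatroid n) where

  ψ-along : ∀ {d} → (Fin d → Fin n) → Pair n → Pair n
  ψ-along g p = foldl (λ q e → ψₖ M e q) p (List.tabulate g)

  ψ-segment : ∀ j d (g : Fin d → Fin n) → (∀ i → toℕ (g i) ≡ j + toℕ i) →
    BijOn (𝒩 M j) (𝒩 M (j + d)) (ψ-along g)
  ψ-segment j zero    g g≡ rewrite +-identityʳ j = BijOn-id
  ψ-segment j (suc d) g g≡ = BijOn-∘
    (subst (λ t → BijOn (𝒩 M t) (𝒩 M (suc t)) (ψₖ M (g zero))) (trans (g≡ zero) (+-identityʳ j))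
           (StepBijection.ψₖ-bijective M (g zero)))
    (subst (λ t → BijOn (𝒩 M (suc j)) (𝒩 M t) (ψ-along (g ∘ suc))) (sym (+-suc j d))
           (ψ-segment (suc j) d (g ∘ suc) (λ i → trans (g≡ (suc i)) (+-suc j (toℕ i)))))

  ψ-bijective : BijOn (𝒩 M 0) (𝒩 M n) (ψ M)
  ψ-bijective = ψ-segment 0 n (λ i → i) (λ _ → refl)

  𝒩₀-characterisation : Loopless M → ∀ N A → 𝒩 M 0 (N , A) ⇔ ((N ≡ ⊥) × InA M A)
  𝒩₀-characterisation loopless N A = mk⇔ to from
    where
    E₀-empty : ∀ i → Eₖ {n} 0 ! i ≡ false
    E₀-empty i = ≥⇒∉Eₖ {i = i} z≤n
    to : 𝒩 M 0 (N , A) → (N ≡ ⊥) × InA M A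
    to x∈ with 𝒩-elim M 0 N A x∈
    ... | N⊑E₀ , _ , nbc , ac = Void⇒≡⊥ N-void , acyclic-intro refute
      where
      N-void : Void N
      N-void i with N ! i in Ni
      ... | false = refl
      ... | true  = ⊥-elim (true≢false (N⊑E₀ i Ni) (E₀-empty i))
      refute : ∀ {X} → X ∈ˡ reorient A (circuits M) → ¬ Void (neg X)
      refute X∈ v with ∈-map⁻ (reorientSet A) X∈
      ... | Y , Y∈ , refl = acyclic⇒¬witness M {0} {N} {A} (NBC⇒Independent M nbc) ac
        (Y∈ , (λ i _ → ─-falseˡ (Eₖ 0) N i (E₀-empty i)) , λ i _ → v i)
    from : (N ≡ ⊥) × InA M A → 𝒩 M 0 (N , A)
    from (refl , inA) = 𝒩-intro M 0 ⊥ A (λ i h → ⊥-elim (true≢false h (!-⊥ i))) (λ i _ → E₀-empty i)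
      (Loopless⇒NBC-⊥ M loopless)
      (¬witness⇒acyclic M {0} {⊥} {A} λ {Y} (Y∈ , _ , pY) →
        Inhabited⇒¬Void {p = neg (reorientSet A Y)} (acyclic⇒neg-inhabited inA (∈-map⁺ (reorientSet A) Y∈))
          (λ i → pY i (!-⊥ i)))

  𝒩ₘ-characterisation : ∀ N A → 𝒩 M n (N , A) ⇔ ((A ≡ ⊥) × NBC M N)
  𝒩ₘ-characterisation N A = mk⇔ to from
    where
    Eₘ-full : ∀ i → Eₖ n ! i ≡ true
    Eₘ-full i = <⇒Eₖ {i = i} (toℕ<n i)
    to : 𝒩 M n (N , A) → (A ≡ ⊥) × NBC M N
    to x∈ with 𝒩-elim M n N A x∈
    ... | _ , dA , nbc , _ = Void⇒≡⊥ (λ i → A-void i) , nbc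
      where
      A-void : ∀ i → A ! i ≡ false
      A-void i with A ! i in Ai
      ... | false = refl
      ... | true  = ⊥-elim (true≢false (Eₘ-full i) (dA i Ai))
    from : (A ≡ ⊥) × NBC M N → 𝒩 M n (N , A)
    from (refl , nbc) = 𝒩-intro M n N ⊥ (λ i _ → Eₘ-full i) (λ i h → ⊥-elim (true≢false h (!-⊥ i))) nbc
      (¬witness⇒acyclic M {n} {N} {⊥} λ {Y} (Y∈ , dY , _) →
        let (i , i∈) = NBC⇒Independent M nbc Y Y∈
            (Yi , Ni) = ─-true (supp Y) N i i∈
        in true≢false (─-intro (Eₖ n) N i (Eₘ-full i) Ni) (dY i Yi))

BijOn-slice : ∀ {X : Set} {P Q : X × X → Set} {P′ Q′ : X → Set} {f : X × X → X × X} (a₀ b₀ : X) →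
  (∀ a b → P (a , b) ⇔ ((a ≡ a₀) × P′ b)) → (∀ a b → Q (a , b) ⇔ ((b ≡ b₀) × Q′ a)) →
  BijOn P Q f → BijOn P′ Q′ (λ b → proj₁ (f (a₀ , b)))
BijOn-slice {P = P} {Q} {P′} {Q′} {f} a₀ b₀ P⇔ Q⇔ (maps-to , injective , onto) =
    (λ b p′ → proj₂ (Q→ (maps-to _ (P← b p′))))
  , (λ b b′ p′ p″ eq → cong proj₂ (injective _ _ (P← b p′) (P← b′ p″)
      (cong₂ _,_ eq (trans (proj₁ (Q→ (maps-to _ (P← b p′)))) (sym (proj₁ (Q→ (maps-to _ (P← b′ p″)))))))))
  , surjective
  where
  P← : ∀ b → P′ b → P (a₀ , b)
  P← b p′ = Equivalence.from (P⇔ a₀ b) (refl , p′)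
  Q→ : ∀ {y} → Q y → (proj₂ y ≡ b₀) × Q′ (proj₁ y)
  Q→ {y} = Equivalence.to (Q⇔ (proj₁ y) (proj₂ y))
  surjective : ∀ a → Q′ a → Σ _ λ b → P′ b × proj₁ (f (a₀ , b)) ≡ a
  surjective a q′ with onto (a , b₀) (Equivalence.from (Q⇔ a b₀) (refl , q′))
  ... | (a₁ , b) , p , fx≡ with Equivalence.to (P⇔ a₁ b) p
  ...   | refl , p′ = b , p′ , cong proj₁ fx≡

mainTheorem5 : ∀ {m} (M : OrientedMatroid m) → Loopless M →
    (∀ (e : Fin m) → BijOn (𝒩 M (toℕ e)) (𝒩 M (suc (toℕ e))) (ψₖ M e))
    × (∀ N A → 𝒩 M 0 (N , A) ⇔ ((N ≡ ⊥) × InA M A))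
    × (∀ N A → 𝒩 M m (N , A) ⇔ ((A ≡ ⊥) × NBC M N))
    × BijOn (𝒩 M 0) (𝒩 M m) (ψ M)
    × BijOn (InA M) (NBC M) (λ A → proj₁ (ψ M (⊥ , A)))
mainTheorem5 M loopless =
    (λ e → StepBijection.ψₖ-bijective M e)
  , 𝒩₀-characterisation M loopless
  , 𝒩ₘ-characterisation M
  , ψ-bijective M
  , BijOn-slice ⊥ ⊥ (𝒩₀-characterisation M loopless) (𝒩ₘ-characterisation M) (ψ-bijective M)
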